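{- Let $n\ge 2$ and let $D=d_1,\dots,d_n$ and $F=f_1,\dots,f_n$ be two tree degree sequences such that $\min_i\{d_i+f_i\}\ge 3$. Then there exist two edge-disjoint caterpillars $T_1,T_2$ on the vertex set $\{v_1,\dots,v_n\}$ such that $T_1$ is a realization of $D$ and $T_2$ is a realization of $F$.
   Context: A degree sequence $D=d_1,\dots,d_n$ is a sequence of non-negative integers; a realization of $D$ is a simple graph on the labeled vertex set $\{v_1,\dots,v_n\}$ in which $v_i$ has degree exactly $d_i$ for every $i$. $D$ is a tree degree sequence (tree sequence) if every $d_i$ is positive and $\sum_{i=1}^n d_i=2n-2$. A caterpillar is a tree whose non-leaf vertices span a path. Two graphs on the same vertex set are edge-disjoint if they have no common edge. -}

module Defs where

open import Data.Nat using (ℕ; zero; suc; _+_; _*_; _∸_; _≤_)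
open import Data.Fin using (Fin)
open import Data.Bool using (Bool; true; false; if_then_else_)
open import Data.List using (List; []; _∷_; allFin; map)
open import Data.Nat.ListAction using (sum)
open import Data.List.Membership.Propositional using (_∈_)
open import Data.List.Relation.Unary.Unique.Propositional using (Unique)
open import Data.List.Relation.Unary.Linked using (Linked)
open import Data.List.Base using (last)
open import Data.Maybe using (just)
open import Data.Product using (Σ; _×_; _,_; ∃)
open import Relation.Binary.PropositionalEquality using (_≡_; _≢_)
open import Relation.Nullary using (¬_)
open import Function.Bundles using (_⇔_)

record Graph (n : ℕ) : Set where
  field
    adj   : Fin n → Fin n → Bool
    sym   : ∀ i j → adj i j ≡ adj j i
    irref : ∀ i → adj i i ≡ false
open Graph public

Adj : ∀ {n} → Graph n → Fin n → Fin n → Set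
Adj G i j = adj G i j ≡ true

deg : ∀ {n} → Graph n → Fin n → ℕ
deg {n} G i = sum (map (λ j → if adj G i j then 1 else 0) (allFin n))

IsWalk : ∀ {n} → Graph n → List (Fin n) → Set
IsWalk G = Linked (Adj G)

Connected : ∀ {n} → Graph n → Set
Connected {n} G = ∀ (u v : Fin n) →
  Σ (List (Fin n)) λ w → IsWalk G (u ∷ w) × last (u ∷ w) ≡ just v

HasCycle : ∀ {n} → Graph n → Set
HasCycle {n} G = Σ (Fin n) λ x → Σ (Fin n) λ y → Σ (Fin n) λ z →
  Σ (List (Fin n)) λ rest → Σ (Fin n) λ l →
    Unique (x ∷ y ∷ z ∷ rest) × IsWalk G (x ∷ y ∷ z ∷ rest) ×
    last (x ∷ y ∷ z ∷ rest) ≡ just l × Adj G l x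

Acyclic : ∀ {n} → Graph n → Set
Acyclic G = ¬ HasCycle G

IsTree : ∀ {n} → Graph n → Set
IsTree G = Connected G × Acyclic G

-- a caterpillar: a tree whose non-leaf vertices (degree ≥ 2) span a path,
-- i.e. there is a path (list of distinct vertices, consecutive ones adjacent)
-- whose vertex set is exactly the set of non-leaf vertices (possibly empty).
IsCaterpillar : ∀ {n} → Graph n → Set
IsCaterpillar {n} G = IsTree G ×
  Σ (List (Fin n)) λ p → Unique p × IsWalk G p ×
    (∀ (v : Fin n) → (v ∈ p) ⇔ (2 ≤ deg G v))

Realizes : ∀ {n} → Graph n → (Fin n → ℕ) → Set
Realizes G d = ∀ i → deg G i ≡ d i

IsTreeSeq : (n : ℕ) → (Fin n → ℕ) → Set
IsTreeSeq n d = (∀ i → 1 ≤ d i) × sum (map d (allFin n)) ≡ 2 * n ∸ 2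

EdgeDisjoint : ∀ {n} → Graph n → Graph n → Set
EdgeDisjoint G H = ∀ i j → ¬ (Adj G i j × Adj H i j)

-- As Σ (dᵢ + fᵢ) = 4n − 4 and every dᵢ + fᵢ ≥ 3,
-- we have n ≥ 4 and some vertex x has dₓ + fₓ = 3; exchanging D and F we may assume
-- dₓ = 1 and fₓ = 2.  For n = 4 the sequences are 2,2,1,1 and 1,1,2,2 up to labelling,
-- and two disjoint paths are written down.  Otherwise x is deleted and d is lowered
-- by one at a vertex y, chosen so that the smaller pair is again admissible:
--   * if d_y ≥ 3, y stays on the spine of T₁ and x becomes a leaf at y;
--   * if all d ≤ 2 and d_y = 2, f_y ≥ 2, then y is a leaf of T₁ hanging at an end of
--     the spine, y joins the spine and x becomes a leaf at y.
-- In T₂ the vertex x subdivides an edge from an end of the spine to one of its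
-- leaves, chosen away from y; this is possible because the reduced T₂ is not a star
-- centred at y.  Then x is adjacent to y only in T₁, and the two trees stay
-- edge-disjoint.  If neither case applies, some z has d_z = 2 and f_z = 1, and the
-- first case applies to z with D and F exchanged unless all dᵢ + fᵢ = 3, which
-- forces n = 4.
--
-- A caterpillar is represented by its spine and a map attaching every other vertex to
-- a spine vertex.  It is a tree because ranking the spine by position and the leaves
-- above it gives every vertex at most one lower neighbour.

module Submission where

open import Defs hiding (sym)
open import Data.Nat using (ℕ; zero; suc; _+_; _*_; _∸_; _≤_; _<_; z≤n; s≤s; pred; _≤?_; >-nonZero)
open import Data.Nat.Properties
open import Algebra.Properties.CommutativeSemigroup +-commutativeSemigroup using (x∙yz≈y∙xz)
open import Data.Nat.Tactic.RingSolver using (solve-∀)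
open import Data.Fin using (Fin; zero; suc)
open import Data.Bool using (Bool; true; false; _∨_; _∧_; not; if_then_else_) renaming (_≟_ to _≟ᵇ_)
open import Data.Bool.Properties using (∨-comm; ∨-assoc; ∨-identityʳ; ∧-comm)
open import Data.List using (List; []; _∷_; length; map; _++_; allFin; _∷ʳ_; reverse; reverseAcc)
open import Data.List.Base using (last)
open import Data.Maybe using (just)
open import Data.Nat.ListAction using (sum)
open import Data.Bool.ListAction using (any)
open import Data.List.Membership.Propositional using (_∈_; _∉_; find; lose)
open import Data.List.Relation.Unary.Any using (here; there; any?)
open import Data.List.Membership.Propositional.Properties using (∈-allFin)
open import Data.List.Relation.Unary.Any.Properties using () renaming (reverse⁻ to ∈-reverse⁻)
open import Data.List.Relation.Unary.All using (All; []; _∷_; tabulate; lookup)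
open import Data.List.Relation.Unary.Unique.Propositional using (Unique; []; _∷_)
open import Data.List.Relation.Unary.Unique.Propositional.Properties using (allFin⁺)
open import Data.List.Relation.Unary.Linked using (Linked; []; [-]; _∷_)
open import Data.Product using (Σ; _×_; _,_; proj₁; proj₂)
open import Data.Sum using (_⊎_; inj₁; inj₂)
open import Data.Empty using (⊥; ⊥-elim)
open import Relation.Nullary using (¬_; Dec; yes; no; does)
open import Relation.Nullary.Decidable using (dec-true; dec-false; _×-dec_)
open import Data.Fin.Properties using () renaming (_≟_ to _≟ᶠ_)
open import Relation.Binary.Definitions using (tri<; tri≈; tri>)
open import Relation.Binary.Construct.Closure.ReflexiveTransitive using (Star; ε; _◅_; _◅◅_)
import Relation.Binary.Construct.Closure.ReflexiveTransitive as Star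
import Data.List.Relation.Unary.AllPairs as AllPairs
import Data.List.Relation.Unary.Unique.Propositional.Properties as Unique
open import Relation.Binary.PropositionalEquality using (_≡_; _≢_; refl; sym; trans; cong; cong₂; subst; ≢-sym; module ≡-Reasoning)
open import Function.Bundles using (mk⇔)
open import Function.Base using (id)
open import Data.List.Properties using (ʳ++-defn; length-tabulate)

eqb : ∀ {n} → Fin n → Fin n → Bool
eqb a b = does (a ≟ᶠ b)

eqb-refl : ∀ {n} (a : Fin n) → eqb a a ≡ true
eqb-refl a = dec-true (a ≟ᶠ a) refl

eqb⇒≡ : ∀ {n} (a b : Fin n) → eqb a b ≡ true → a ≡ b
eqb⇒≡ a b e with a ≟ᶠ b
... | yes p = p

≢⇒eqb-false : ∀ {n} (a b : Fin n) → a ≢ b → eqb a b ≡ false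
≢⇒eqb-false a b = dec-false (a ≟ᶠ b)

eqb-false⇒≢ : ∀ {n} (a b : Fin n) → eqb a b ≡ false → a ≢ b
eqb-false⇒≢ a b e with a ≟ᶠ b
... | no p = p

-- The shape of Defs.deg, so that deg G v is countOn (allFin n) (adj G v) by definition.
bool→ℕ : Bool → ℕ
bool→ℕ b = if b then 1 else 0

sumOn : ∀ {n} → List (Fin n) → (Fin n → ℕ) → ℕ
sumOn V h = sum (map h V)

countOn : ∀ {n} → List (Fin n) → (Fin n → Bool) → ℕ
countOn V g = sumOn V (λ u → bool→ℕ (g u))

memb : ∀ {n} → Fin n → List (Fin n) → Bool
memb v = any (λ a → eqb a v)

memb⇒∈ : ∀ {n} (v : Fin n) (s : List (Fin n)) → memb v s ≡ true → v ∈ s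
memb⇒∈ v [] ()
memb⇒∈ v (a ∷ s) e with eqb a v in e2
... | true = here (sym (eqb⇒≡ a v e2))
... | false = there (memb⇒∈ v s e)

∈⇒memb : ∀ {n} {v : Fin n} {s : List (Fin n)} → v ∈ s → memb v s ≡ true
∈⇒memb {v = v} (here refl) rewrite eqb-refl v = refl
∈⇒memb {v = v} {a ∷ s} (there p) rewrite ∈⇒memb p with eqb a v
... | true = refl
... | false = refl

memb-false⇒∉ : ∀ {n} {v : Fin n} {s : List (Fin n)} → memb v s ≡ false → v ∉ s
memb-false⇒∉ e p with trans (sym e) (∈⇒memb p)
... | ()

∉⇒memb-false : ∀ {n} (v : Fin n) (s : List (Fin n)) → v ∉ s → memb v s ≡ false
∉⇒memb-false v s np with memb v s in e
... | true = ⊥-elim (np (memb⇒∈ v s e))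
... | false = refl

search : ∀ {n} {P : Fin n → Set} → (∀ u → Dec (P u)) → (V : List (Fin n)) →
         (Σ (Fin n) λ u → u ∈ V × P u) ⊎ (∀ u → u ∈ V → ¬ P u)
search P? V with any? P? V
... | yes p = inj₁ (find p)
... | no ¬p = inj₂ (λ u m pu → ¬p (lose m pu))

remove : ∀ {n} → Fin n → List (Fin n) → List (Fin n)
remove x [] = []
remove x (a ∷ t) with eqb a x
... | true = remove x t
... | false = a ∷ remove x t

∈-remove⁻ : ∀ {n} {v x : Fin n} (V : List (Fin n)) → v ∈ remove x V → v ∈ V × v ≢ x
∈-remove⁻ {x = x} (a ∷ t) m with eqb a x in e
... | true = let (m' , ne) = ∈-remove⁻ t m in there m' , ne
∈-remove⁻ {x = x} (a ∷ t) (here refl) | false = here refl , eqb-false⇒≢ a x e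
∈-remove⁻ {x = x} (a ∷ t) (there m) | false = let (m' , ne) = ∈-remove⁻ t m in there m' , ne

∈-remove⁺ : ∀ {n} {v x : Fin n} (V : List (Fin n)) → v ∈ V → v ≢ x → v ∈ remove x V
∈-remove⁺ {x = x} (a ∷ t) m ne with eqb a x in e
∈-remove⁺ {x = x} (a ∷ t) (here refl) ne | true = ⊥-elim (ne (eqb⇒≡ a x e))
∈-remove⁺ {x = x} (a ∷ t) (there m) ne | true = ∈-remove⁺ t m ne
∈-remove⁺ {x = x} (a ∷ t) (here refl) ne | false = here refl
∈-remove⁺ {x = x} (a ∷ t) (there m) ne | false = there (∈-remove⁺ t m ne)

remove-∉ : ∀ {n} (x : Fin n) (V : List (Fin n)) → x ∉ V → remove x V ≡ V
remove-∉ x [] _ = refl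
remove-∉ x (a ∷ t) nm with eqb a x in e
... | true = ⊥-elim (nm (here (sym (eqb⇒≡ a x e))))
... | false = cong (a ∷_) (remove-∉ x t (λ m → nm (there m)))

remove-unique : ∀ {n} (x : Fin n) {V : List (Fin n)} → Unique V → Unique (remove x V)
remove-unique x [] = []
remove-unique x {a ∷ t} (h ∷ u) with eqb a x
... | true = remove-unique x u
... | false = tabulate (λ m → lookup h (proj₁ (∈-remove⁻ t m))) ∷ remove-unique x u

∉-remove : ∀ {n} (x : Fin n) (V : List (Fin n)) → x ∉ remove x V
∉-remove x V m = proj₂ (∈-remove⁻ V m) refl

sumOn-remove : ∀ {n} {V : List (Fin n)} {x : Fin n} (h : Fin n → ℕ) → Unique V → x ∈ V →
            sumOn V h ≡ h x + sumOn (remove x V) h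
sumOn-remove {V = a ∷ t} {x} h (na ∷ u) m with eqb a x in e
... | true with eqb⇒≡ a x e
... | refl = cong (h a +_) (cong (λ l → sumOn l h) (sym (remove-∉ a t (λ m' → lookup na m' refl))))
sumOn-remove {V = a ∷ t} {x} h (na ∷ u) (here refl) | false = ⊥-elim (eqb-false⇒≢ a a e refl)
sumOn-remove {V = a ∷ t} {x} h (na ∷ u) (there m) | false =
  trans (cong (h a +_) (sumOn-remove h u m)) (x∙yz≈y∙xz (h a) (h x) _)

sumOn-cong : ∀ {n} (V : List (Fin n)) {h k : Fin n → ℕ} → (∀ u → u ∈ V → h u ≡ k u) → sumOn V h ≡ sumOn V k
sumOn-cong [] f = refl
sumOn-cong (a ∷ V) f = cong₂ _+_ (f a (here refl)) (sumOn-cong V (λ u m → f u (there m)))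

sumOn-mono : ∀ {n} (V : List (Fin n)) {h k : Fin n → ℕ} → (∀ u → u ∈ V → h u ≤ k u) → sumOn V h ≤ sumOn V k
sumOn-mono [] f = z≤n
sumOn-mono (a ∷ V) f = +-mono-≤ (f a (here refl)) (sumOn-mono V (λ u m → f u (there m)))

sumOn-≥ : ∀ {n} (V : List (Fin n)) (c : ℕ) {h : Fin n → ℕ} → (∀ u → u ∈ V → c ≤ h u) → length V * c ≤ sumOn V h
sumOn-≥ [] c f = z≤n
sumOn-≥ (a ∷ V) c f = +-mono-≤ (f a (here refl)) (sumOn-≥ V c (λ u m → f u (there m)))

sumOn-+ : ∀ {n} (V : List (Fin n)) (h k : Fin n → ℕ) → sumOn V (λ u → h u + k u) ≡ sumOn V h + sumOn V k
sumOn-+ [] h k = refl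
sumOn-+ (a ∷ V) h k rewrite sumOn-+ V h k =
  trans (+-assoc (h a) (k a) _) (trans (cong (h a +_) (x∙yz≈y∙xz (k a) (sumOn V h) (sumOn V k))) (sym (+-assoc (h a) (sumOn V h) _)))

sumOn-zero : ∀ {n} (V : List (Fin n)) → sumOn V (λ _ → 0) ≡ 0
sumOn-zero [] = refl
sumOn-zero (a ∷ V) = sumOn-zero V

sumOn-one : ∀ {n} (V : List (Fin n)) → sumOn V (λ _ → 1) ≡ length V
sumOn-one [] = refl
sumOn-one (a ∷ V) = cong suc (sumOn-one V)

length-remove : ∀ {n} {V : List (Fin n)} {x : Fin n} → Unique V → x ∈ V → length V ≡ suc (length (remove x V))
length-remove {V = V} {x} u m = trans (sym (sumOn-one V)) (trans (sumOn-remove (λ _ → 1) u m) (cong suc (sumOn-one (remove x V))))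

sumOn-const : ∀ {n} (V : List (Fin n)) c → sumOn V (λ _ → c) ≡ length V * c
sumOn-const [] c = refl
sumOn-const (a ∷ V) c = cong (c +_) (sumOn-const V c)

sumOn-⊆⊇ : ∀ {n} {V W : List (Fin n)} (h : Fin n → ℕ) → Unique V → Unique W →
          (∀ v → v ∈ V → v ∈ W) → (∀ v → v ∈ W → v ∈ V) → sumOn V h ≡ sumOn W h
sumOn-⊆⊇ {V = []} {[]} h _ _ _ _ = refl
sumOn-⊆⊇ {V = []} {w ∷ W} h _ _ _ WV with WV w (here refl)
... | ()
sumOn-⊆⊇ {V = a ∷ V} {W} h (na ∷ uV) uW VW WV =
  trans (cong (h a +_) (sumOn-⊆⊇ h uV (remove-unique a uW)
           (λ v m → ∈-remove⁺ W (VW v (there m)) (λ q → lookup na m (sym q)))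
           (λ v m → back v m)))
        (sym (sumOn-remove h uW (VW a (here refl))))
  where
  back : ∀ v → v ∈ remove a W → v ∈ V
  back v m with ∈-remove⁻ W m
  ... | m' , ne with WV v m'
  ... | here q = ⊥-elim (ne q)
  ... | there q = q

countOn-none : ∀ {n} (V : List (Fin n)) {g : Fin n → Bool} → (∀ u → u ∈ V → g u ≡ false) → countOn V g ≡ 0
countOn-none V {g} f = trans (sumOn-cong V (λ u m → cong bool→ℕ (f u m))) (sumOn-zero V)

countOn-eqb : ∀ {n} {V : List (Fin n)} {y : Fin n} → Unique V → y ∈ V → countOn V (eqb y) ≡ 1
countOn-eqb {V = V} {y} u m rewrite sumOn-remove (λ v → bool→ℕ (eqb y v)) u m | eqb-refl y =
  cong suc (countOn-none (remove y V) (λ v m' → ≢⇒eqb-false y v (λ e → proj₂ (∈-remove⁻ V m') (sym e))))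

countOn-eqb≤1 : ∀ {n} {V : List (Fin n)} (y : Fin n) → Unique V → countOn V (eqb y) ≤ 1
countOn-eqb≤1 {V = V} y u with memb y V in e
... | true = ≤-reflexive (countOn-eqb u (memb⇒∈ y V e))
... | false = ≤-trans (≤-reflexive (countOn-none V (λ v m → ≢⇒eqb-false y v (λ { refl → memb-false⇒∉ e m })))) z≤n

bool→ℕ-∨ : ∀ p q → bool→ℕ (p ∨ q) ≤ bool→ℕ p + bool→ℕ q
bool→ℕ-∨ true q = s≤s z≤n
bool→ℕ-∨ false q = ≤-refl

countOn-∨ : ∀ {n} (V : List (Fin n)) (g h : Fin n → Bool) → countOn V (λ u → g u ∨ h u) ≤ countOn V g + countOn V h
countOn-∨ V g h = ≤-trans (sumOn-mono V (λ u _ → bool→ℕ-∨ (g u) (h u)))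
                          (≤-reflexive (sumOn-+ V (λ u → bool→ℕ (g u)) (λ u → bool→ℕ (h u))))

countOn-memb≤length : ∀ {n} {V : List (Fin n)} (L : List (Fin n)) → Unique V → countOn V (λ u → memb u L) ≤ length L
countOn-memb≤length {V = V} [] u = ≤-reflexive (countOn-none V (λ _ _ → refl))
countOn-memb≤length {V = V} (a ∷ L) u = ≤-trans (countOn-∨ V (eqb a) (λ v → memb v L)) (+-mono-≤ (countOn-eqb≤1 a u) (countOn-memb≤length L u))

bool→ℕ-mono : ∀ p q → (p ≡ true → q ≡ true) → bool→ℕ p ≤ bool→ℕ q
bool→ℕ-mono false q f = z≤n
bool→ℕ-mono true q f rewrite f refl = ≤-refl

countOn-mono : ∀ {n} (V : List (Fin n)) (g h : Fin n → Bool) → (∀ u → u ∈ V → g u ≡ true → h u ≡ true) → countOn V g ≤ countOn V h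
countOn-mono V g h f = sumOn-mono V (λ u m → bool→ℕ-mono (g u) (h u) (f u m))

∨-trueʳ : ∀ p {q} → q ≡ true → p ∨ q ≡ true
∨-trueʳ true e = refl
∨-trueʳ false e = e

∨-trueˡ : ∀ {p} q → p ≡ true → p ∨ q ≡ true
∨-trueˡ q refl = refl

∨-true⁻ : ∀ p q → p ∨ q ≡ true → p ≡ true ⊎ q ≡ true
∨-true⁻ true q e = inj₁ refl
∨-true⁻ false q e = inj₂ e

∨-false : ∀ {p q} → p ≡ false → q ≡ false → p ∨ q ≡ false
∨-false refl refl = refl

∧-true⁻ : ∀ p q → p ∧ q ≡ true → p ≡ true × q ≡ true
∧-true⁻ true true e = refl , refl

∨-identityʳ²-∨ : ∀ b {z c} → z ≡ c → ((b ∨ false) ∨ false) ∨ z ≡ b ∨ c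
∨-identityʳ²-∨ b refl = cong (_∨ _) (trans (∨-identityʳ _) (∨-identityʳ b))

∧-trueˡ : ∀ p q → p ∧ q ≡ true → p ≡ true
∧-trueˡ true q e = refl

∧-trueʳ : ∀ p q → p ∧ q ≡ true → q ≡ true
∧-trueʳ true q e = e

not-true : ∀ p → not p ≡ true → p ≡ false
not-true false e = refl

countOn>length⇒∃∉ : ∀ {n} {V : List (Fin n)} (g : Fin n → Bool) (L : List (Fin n)) → Unique V →
         suc (length L) ≤ countOn V g → Σ (Fin n) λ u → u ∈ V × g u ≡ true × memb u L ≡ false
countOn>length⇒∃∉ {V = V} g L uV le with search (λ u → g u ∧ not (memb u L) ≟ᵇ true) V
... | inj₁ (u , m , e) = u , m , ∧-trueˡ (g u) _ e , not-true (memb u L) (∧-trueʳ (g u) _ e)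
countOn>length⇒∃∉ {V = V} g L uV le | inj₂ f =
  ⊥-elim (<⇒≱ le (≤-trans (countOn-mono V g (λ u → memb u L) h) (countOn-memb≤length L uV)))
  where
  h : ∀ u → u ∈ V → g u ≡ true → memb u L ≡ true
  h u m gu with memb u L in e
  ... | true = refl
  ... | false = ⊥-elim (f u m (subst (λ b → b ∧ not (memb u L) ≡ true) (sym gu) (cong not e)))

countOn≥3 : ∀ {n} {V : List (Fin n)} (g : Fin n → Bool) {a b c : Fin n} → Unique V →
            a ∈ V → b ∈ V → c ∈ V → a ≢ b → a ≢ c → b ≢ c →
            g a ≡ true → g b ≡ true → g c ≡ true → 3 ≤ countOn V g
countOn≥3 {V = V} g {a} {b} {c} u ma mb mc ab ac bc ga gb gc
  rewrite sumOn-remove (λ v → bool→ℕ (g v)) u ma | ga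
        | sumOn-remove (λ v → bool→ℕ (g v)) (remove-unique a u) (∈-remove⁺ V mb (λ e → ab (sym e))) | gb
        | sumOn-remove (λ v → bool→ℕ (g v)) (remove-unique b (remove-unique a u))
             (∈-remove⁺ (remove a V) (∈-remove⁺ V mc (λ e → ac (sym e))) (λ e → bc (sym e))) | gc
  = s≤s (s≤s (s≤s z≤n))

countOn-trade : ∀ {n} {V : List (Fin n)} (x w : Fin n) (p q : Fin n → Bool) → Unique V → w ∈ V →
                p x ≡ true → p w ≡ false → q w ≡ true → (∀ u → u ∈ remove w V → p u ≡ q u) →
                countOn (x ∷ V) p ≡ countOn V q
countOn-trade {V = V} x w p q uV mw px pw qw rest = begin
  bool→ℕ (p x) + countOn V p                   ≡⟨ cong₂ _+_ (cong bool→ℕ px) (sumOn-remove (λ u → bool→ℕ (p u)) uV mw) ⟩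
  1 + (bool→ℕ (p w) + countOn (remove w V) p)  ≡⟨ cong (λ b → 1 + (bool→ℕ b + countOn (remove w V) p)) pw ⟩
  1 + countOn (remove w V) p                   ≡⟨ cong suc (sumOn-cong (remove w V) (λ u m → cong bool→ℕ (rest u m))) ⟩
  1 + countOn (remove w V) q                   ≡⟨ cong (λ b → bool→ℕ b + countOn (remove w V) q) qw ⟨
  bool→ℕ (q w) + countOn (remove w V) q        ≡⟨ sumOn-remove (λ u → bool→ℕ (q u)) uV mw ⟨
  countOn V q                                  ∎
  where open ≡-Reasoning

countOn≡2 : ∀ {n} {V : List (Fin n)} (g : Fin n → Bool) {a b : Fin n} → Unique V →
          a ∈ V → b ∈ V → a ≢ b → g a ≡ true → g b ≡ true →
          (∀ u → u ∈ V → u ≢ a → u ≢ b → g u ≡ false) → countOn V g ≡ 2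
countOn≡2 {V = V} g {a} {b} u ma mb ab ga gb rest
  rewrite sumOn-remove (λ v → bool→ℕ (g v)) u ma | ga
        | sumOn-remove (λ v → bool→ℕ (g v)) (remove-unique a u) (∈-remove⁺ V mb (λ e → ab (sym e))) | gb
  = cong (λ k → suc (suc k)) (countOn-none _ (λ v m →
      let (m1 , nb) = ∈-remove⁻ (remove a V) m in
      let (m2 , na) = ∈-remove⁻ V m1 in rest v m2 na nb))

-- Caterpillars given by a spine and an attachment map

consec : ∀ {n} → List (Fin n) → Fin n → Fin n → Bool
consec [] u v = false
consec (a ∷ []) u v = false
consec (a ∷ b ∷ t) u v = (eqb a u ∧ eqb b v) ∨ consec (b ∷ t) u v

spineAdj : ∀ {n} → List (Fin n) → Fin n → Fin n → Bool
spineAdj s u v = consec s u v ∨ consec s v u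

-- Consecutive vertices of the spine s are adjacent, and every vertex v off the
-- spine is a leaf hanging at att v (att is irrelevant on the spine).
catAdj : ∀ {n} → List (Fin n) → (Fin n → Fin n) → Fin n → Fin n → Bool
catAdj s att u v = spineAdj s u v ∨ ((not (memb u s) ∧ eqb (att u) v) ∨ (not (memb v s) ∧ eqb (att v) u))

consec⇒∈ : ∀ {n} (s : List (Fin n)) {u v : Fin n} → consec s u v ≡ true → u ∈ s × v ∈ s
consec⇒∈ [] ()
consec⇒∈ (a ∷ []) ()
consec⇒∈ (a ∷ b ∷ t) {u} {v} e with consec⇒∈ (b ∷ t) {u} {v} | eqb a u in e1 | eqb b v in e2
... | _ | true | true = here (sym (eqb⇒≡ a u e1)) , there (here (sym (eqb⇒≡ b v e2)))
... | ih | true | false = let u∈ , v∈ = ih e in there u∈ , there v∈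
... | ih | false | _ = let u∈ , v∈ = ih e in there u∈ , there v∈

consec-∉ˡ : ∀ {n} (s : List (Fin n)) {u : Fin n} (v : Fin n) → u ∉ s → consec s u v ≡ false
consec-∉ˡ s {u} v nu with consec s u v in e
... | true = ⊥-elim (nu (proj₁ (consec⇒∈ s e)))
... | false = refl

consec-∉ʳ : ∀ {n} (s : List (Fin n)) (u : Fin n) {v : Fin n} → v ∉ s → consec s u v ≡ false
consec-∉ʳ s u {v} nv with consec s u v in e
... | true = ⊥-elim (nv (proj₂ (consec⇒∈ s e)))
... | false = refl

spineAdj-∉ : ∀ {n} (s : List (Fin n)) {u : Fin n} (v : Fin n) → u ∉ s → spineAdj s u v ≡ false
spineAdj-∉ s v nu = ∨-false (consec-∉ˡ s v nu) (consec-∉ʳ s v nu)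

consec-irrefl : ∀ {n} {s : List (Fin n)} (u : Fin n) → Unique s → consec s u u ≡ false
consec-irrefl {s = []} u _ = refl
consec-irrefl {s = a ∷ []} u _ = refl
consec-irrefl {s = a ∷ b ∷ t} u ((nab ∷ _) ∷ us) with eqb a u in e1
... | false = consec-irrefl u us
... | true with eqb b u in e2
... | false = consec-irrefl u us
... | true = ⊥-elim (nab (trans (eqb⇒≡ a u e1) (sym (eqb⇒≡ b u e2))))

consec-into-head : ∀ {n} {a : Fin n} {t : List (Fin n)} (c : Fin n) → Unique (a ∷ t) → consec (a ∷ t) c a ≡ false
consec-into-head {t = []} c _ = refl
consec-into-head {a = a} {t = b ∷ t} c ((nab ∷ na) ∷ us) with eqb a c ∧ eqb b a in e
... | true = ⊥-elim (nab (sym (eqb⇒≡ b a (proj₂ (∧-true⁻ _ _ e)))))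
... | false = consec-∉ʳ (b ∷ t) c (λ m → lookup (nab ∷ na) m refl)

consec-head : ∀ {n} (a b : Fin n) (t : List (Fin n)) → consec (a ∷ b ∷ t) a b ≡ true
consec-head a b t rewrite eqb-refl a | eqb-refl b = refl

consec-∷ : ∀ {n} (a : Fin n) (t : List (Fin n)) {u v : Fin n} → consec t u v ≡ true → consec (a ∷ t) u v ≡ true
consec-∷ a [] ()
consec-∷ a (b ∷ t) e = ∨-trueʳ _ e

consec-from-head : ∀ {n} {a b : Fin n} {t : List (Fin n)} {v : Fin n} → Unique (a ∷ b ∷ t) →
                  consec (a ∷ b ∷ t) a v ≡ true → v ≡ b
consec-from-head {a = a} {b} {t} {v} ((nab ∷ na) ∷ us) e rewrite eqb-refl a with eqb b v in e2
... | true = sym (eqb⇒≡ b v e2)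
... | false = ⊥-elim (lookup (nab ∷ na) (proj₁ (consec⇒∈ (b ∷ t) e)) refl)

consec-pred-unique : ∀ {n} {s : List (Fin n)} {u c b : Fin n} → Unique s →
                     consec s u b ≡ true → consec s c b ≡ true → u ≡ c
consec-pred-unique {s = []} _ ()
consec-pred-unique {s = a ∷ []} _ ()
consec-pred-unique {s = a ∷ a′ ∷ t} {u} {c} {b} (h ∷ us) e1 e2
  with ∨-true⁻ (eqb a u ∧ eqb a′ b) _ e1 | ∨-true⁻ (eqb a c ∧ eqb a′ b) _ e2
... | inj₂ x | inj₂ y = consec-pred-unique us x y
... | inj₁ x | inj₁ y = trans (sym (eqb⇒≡ a u (proj₁ (∧-true⁻ _ _ x)))) (eqb⇒≡ a c (proj₁ (∧-true⁻ _ _ y)))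
... | inj₁ x | inj₂ y with eqb⇒≡ a′ b (proj₂ (∧-true⁻ _ _ x))
... | refl with trans (sym (consec-into-head c us)) y
... | ()
consec-pred-unique {s = a ∷ a′ ∷ t} {u} {c} {b} (h ∷ us) e1 e2 | inj₂ x | inj₁ y with eqb⇒≡ a′ b (proj₂ (∧-true⁻ _ _ y))
... | refl with trans (sym (consec-into-head u us)) x
... | ()

spineAdj-head : ∀ {n} {a b : Fin n} {t : List (Fin n)} {u : Fin n} → Unique (a ∷ b ∷ t) →
            spineAdj (a ∷ b ∷ t) a u ≡ true → u ≡ b
spineAdj-head {a = a} {b} {t} {u} us e with ∨-true⁻ (consec (a ∷ b ∷ t) a u) _ e
... | inj₁ x = consec-from-head us x
... | inj₂ y with trans (sym (consec-into-head u us)) y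
... | ()

spineAdj-sym : ∀ {n} (s : List (Fin n)) u v → spineAdj s u v ≡ spineAdj s v u
spineAdj-sym s u v = ∨-comm (consec s u v) (consec s v u)

catAdj-sym : ∀ {n} (s : List (Fin n)) att (u v : Fin n) → catAdj s att u v ≡ catAdj s att v u
catAdj-sym s att u v = cong₂ _∨_ (spineAdj-sym s u v) (∨-comm (not (memb u s) ∧ eqb (att u) v) _)

consec-reverseAcc : ∀ {n} (t : List (Fin n)) (a : Fin n) (acc : List (Fin n)) (u v : Fin n) →
                    consec (reverseAcc (a ∷ acc) t) u v ≡ consec (a ∷ t) v u ∨ consec (a ∷ acc) u v
consec-reverseAcc [] a acc u v = refl
consec-reverseAcc (b ∷ t) a acc u v = begin
  consec (reverseAcc (b ∷ a ∷ acc) t) u v                    ≡⟨ consec-reverseAcc t b (a ∷ acc) u v ⟩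
  consec (b ∷ t) v u ∨ ((eqb b u ∧ eqb a v) ∨ consec (a ∷ acc) u v)
    ≡⟨ cong (λ z → consec (b ∷ t) v u ∨ (z ∨ consec (a ∷ acc) u v)) (∧-comm (eqb b u) (eqb a v)) ⟩
  consec (b ∷ t) v u ∨ ((eqb a v ∧ eqb b u) ∨ consec (a ∷ acc) u v)
    ≡⟨ sym (∨-assoc (consec (b ∷ t) v u) _ _) ⟩
  (consec (b ∷ t) v u ∨ (eqb a v ∧ eqb b u)) ∨ consec (a ∷ acc) u v
    ≡⟨ cong (_∨ consec (a ∷ acc) u v) (∨-comm (consec (b ∷ t) v u) _) ⟩
  ((eqb a v ∧ eqb b u) ∨ consec (b ∷ t) v u) ∨ consec (a ∷ acc) u v ∎
  where open ≡-Reasoning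

consec-reverse : ∀ {n} (s : List (Fin n)) (u v : Fin n) → consec (reverse s) u v ≡ consec s v u
consec-reverse [] u v = refl
consec-reverse (a ∷ t) u v = trans (consec-reverseAcc t a [] u v) (∨-identityʳ _)

spineAdj-reverse : ∀ {n} (s : List (Fin n)) (u v : Fin n) → spineAdj (reverse s) u v ≡ spineAdj s u v
spineAdj-reverse s u v rewrite consec-reverse s u v | consec-reverse s v u = ∨-comm (consec s v u) _

memb-reverseAcc : ∀ {n} (v : Fin n) (t acc : List (Fin n)) → memb v (reverseAcc acc t) ≡ memb v t ∨ memb v acc
memb-reverseAcc v [] acc = refl
memb-reverseAcc v (a ∷ t) acc rewrite memb-reverseAcc v t (a ∷ acc) =
  trans (sym (∨-assoc (memb v t) (eqb a v) _)) (cong (_∨ memb v acc) (∨-comm (memb v t) (eqb a v)))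

memb-reverse : ∀ {n} (v : Fin n) (s : List (Fin n)) → memb v (reverse s) ≡ memb v s
memb-reverse v s = trans (memb-reverseAcc v s []) (∨-identityʳ _)

Unique-reverseAcc : ∀ {n} {t acc : List (Fin n)} → Unique t → Unique acc → (∀ v → v ∈ t → v ∉ acc) →
                    Unique (reverseAcc acc t)
Unique-reverseAcc {t = []} _ ua _ = ua
Unique-reverseAcc {t = a ∷ t} {acc} (na ∷ ut) ua dis =
  Unique-reverseAcc ut (tabulate (λ {v} m e → dis a (here refl) (subst (_∈ acc) (sym e) m)) ∷ ua)
    (λ v m → λ { (here e) → lookup na m (sym e) ; (there m') → dis v (there m) m' })

Unique-reverse : ∀ {n} {s : List (Fin n)} → Unique s → Unique (reverse s)
Unique-reverse us = Unique-reverseAcc us [] (λ _ _ ())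

reverseAcc-shape : ∀ {n} (t : List (Fin n)) (b c : Fin n) (acc : List (Fin n)) →
                   Σ (Fin n) λ p → Σ (Fin n) λ q → Σ (List (Fin n)) λ r →
                     reverseAcc (b ∷ c ∷ acc) t ≡ p ∷ q ∷ r × (p ≡ b ⊎ p ∈ t)
reverseAcc-shape [] b c acc = b , c , acc , refl , inj₁ refl
reverseAcc-shape (a ∷ t) b c acc with reverseAcc-shape t a b (c ∷ acc)
... | p , q , r , e , inj₁ refl = p , q , r , e , inj₂ (here refl)
... | p , q , r , e , inj₂ m = p , q , r , e , inj₂ (there m)

spine-position : ∀ {n} {s : List (Fin n)} {w : Fin n} → Unique s → w ∈ s →
            (Σ (List (Fin n)) λ t → s ≡ w ∷ t) ⊎ (Σ (List (Fin n)) λ r → reverse s ≡ w ∷ r) ⊎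
            (Σ (Fin n) λ a → Σ (Fin n) λ b → a ≢ b × consec s a w ≡ true × consec s w b ≡ true)
spine-position {s = a ∷ t} us (here refl) = inj₁ (t , refl)
spine-position {s = a ∷ t} {w} (na ∷ ut) (there m) with spine-position ut m
... | inj₁ ([] , refl) = inj₂ (inj₁ (a ∷ [] , refl))
... | inj₁ (b ∷ t' , refl) =
      inj₂ (inj₂ (a , b , (λ e → lookup na (there (here e)) refl) , consec-head a w (b ∷ t') , consec-∷ a (w ∷ b ∷ t') (consec-head w b t')))
... | inj₂ (inj₁ (r , e)) = inj₂ (inj₁ (r ++ a ∷ [] , trans (ʳ++-defn t) (cong (_++ a ∷ []) e)))
... | inj₂ (inj₂ (x , y , ne , c₁ , c₂)) = inj₂ (inj₂ (x , y , ne , consec-∷ a t c₁ , consec-∷ a t c₂))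

record Caterpillar {n} (V : List (Fin n)) (g : Fin n → ℕ) (sp : List (Fin n)) (att : Fin n → Fin n) : Set where
  field
    spine-unique : Unique sp
    spine⊆ : ∀ v → v ∈ sp → v ∈ V
    leaf-attached : ∀ v → v ∈ V → memb v sp ≡ false → memb (att v) sp ≡ true
    degree : ∀ v → v ∈ V → countOn V (catAdj sp att v) ≡ g v
    spine⇒deg≥2 : ∀ v → v ∈ V → memb v sp ≡ true → 2 ≤ g v
    deg≥2⇒spine : ∀ v → v ∈ V → 2 ≤ g v → memb v sp ≡ true
open Caterpillar public

update : ∀ {n} → (Fin n → Fin n) → Fin n → Fin n → Fin n → Fin n
update f a b v = if eqb a v then b else f v

update-same : ∀ {n} (f : Fin n → Fin n) a b → update f a b a ≡ b
update-same f a b rewrite eqb-refl a = refl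

update-other : ∀ {n} (f : Fin n → Fin n) a b {v} → a ≢ v → update f a b v ≡ f v
update-other f a b {v} ne rewrite ≢⇒eqb-false a v ne = refl

noLeafAt-offSpine : ∀ {n} (sp : List (Fin n)) (att : Fin n → Fin n) (v x : Fin n) →
              (memb v sp ≡ false → memb (att v) sp ≡ true) → x ∉ sp →
              (not (memb v sp) ∧ eqb (att v) x) ≡ false
noLeafAt-offSpine sp att v x attached nx with memb v sp in e
... | true = refl
... | false = ≢⇒eqb-false (att v) x (λ q → nx (subst (_∈ sp) q (memb⇒∈ (att v) sp (attached refl))))

catAdj-fresh : ∀ {n} (sp : List (Fin n)) (att : Fin n → Fin n) (x y v : Fin n) → x ∉ sp → att x ≡ y →
            (memb v sp ≡ false → memb (att v) sp ≡ true) → catAdj sp att x v ≡ eqb y v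
catAdj-fresh sp att x y v nx ax attached rewrite spineAdj-∉ sp v nx | ∉⇒memb-false x sp nx | ax | noLeafAt-offSpine sp att v x attached nx =
  ∨-identityʳ (eqb y v)

catAdj-irrefl : ∀ {n} (sp : List (Fin n)) (att : Fin n → Fin n) (v : Fin n) → Unique sp →
           (memb v sp ≡ false → memb (att v) sp ≡ true) → catAdj sp att v v ≡ false
catAdj-irrefl sp att v us attached with memb v sp in e
... | true rewrite consec-irrefl v us = refl
... | false rewrite consec-irrefl v us | ≢⇒eqb-false (att v) v (λ q → memb-false⇒∉ e (subst (_∈ sp) q (memb⇒∈ (att v) sp (attached refl)))) = refl

Caterpillar-transport : ∀ {n} {V W : List (Fin n)} {g g' : Fin n → ℕ} {sp att} → Caterpillar V g sp att →
            (∀ v → v ∈ W → v ∈ V) → (∀ v → v ∈ V → v ∈ W) → (∀ k → countOn W k ≡ countOn V k) →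
            (∀ v → v ∈ W → g' v ≡ g v) → Caterpillar W g' sp att
Caterpillar-transport {sp = sp} {att} C WV VW cWV gg = record
  { spine-unique = spine-unique C
  ; spine⊆ = λ v m → VW v (spine⊆ C v m)
  ; leaf-attached = λ v m → leaf-attached C v (WV v m)
  ; degree = λ v m → trans (cWV (catAdj sp att v)) (trans (degree C v (WV v m)) (sym (gg v m)))
  ; spine⇒deg≥2 = λ v m e → subst (2 ≤_) (sym (gg v m)) (spine⇒deg≥2 C v (WV v m) e)
  ; deg≥2⇒spine = λ v m le → deg≥2⇒spine C v (WV v m) (subst (2 ≤_) (gg v m) le)
  }

catAdj-reverse : ∀ {n} (sp : List (Fin n)) att u v → catAdj (reverse sp) att u v ≡ catAdj sp att u v
catAdj-reverse sp att u v rewrite spineAdj-reverse sp u v | memb-reverse u sp | memb-reverse v sp = refl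

Caterpillar-reverse : ∀ {n} {V : List (Fin n)} {g sp att} → Caterpillar V g sp att → Caterpillar V g (reverse sp) att
Caterpillar-reverse {V = V} {sp = sp} {att} C = record
  { spine-unique = Unique-reverse (spine-unique C)
  ; spine⊆ = λ v m → spine⊆ C v (∈-reverse⁻ m)
  ; leaf-attached = λ v m e → trans (memb-reverse (att v) sp) (leaf-attached C v m (trans (sym (memb-reverse v sp)) e))
  ; degree = λ v m → trans (sumOn-cong V (λ u _ → cong bool→ℕ (catAdj-reverse sp att v u))) (degree C v m)
  ; spine⇒deg≥2 = λ v m e → spine⇒deg≥2 C v m (trans (sym (memb-reverse v sp)) e)
  ; deg≥2⇒spine = λ v m le → trans (memb-reverse v sp) (deg≥2⇒spine C v m le)
  }

attachToSpine-old : ∀ {n} (sp : List (Fin n)) att (x y u v : Fin n) → x ≢ u → x ≢ v →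
          catAdj sp (update att x y) u v ≡ catAdj sp att u v
attachToSpine-old sp att x y u v nu nv rewrite update-other att x y nu | update-other att x y nv = refl

attachToSpine : ∀ {n} {V' : List (Fin n)} {g' g : Fin n → ℕ} {sp att} (x y : Fin n) →
      Caterpillar V' g' sp att → Unique V' → x ∉ V' → y ∈ V' → memb y sp ≡ true →
      g x ≡ 1 → g y ≡ suc (g' y) → (∀ v → v ∈ V' → v ≢ y → g v ≡ g' v) →
      Caterpillar (x ∷ V') g sp (update att x y)
attachToSpine {V' = V'} {g'} {g} {sp} {att} x y C uV nx my ys gx gy go = record
  { spine-unique = spine-unique C
  ; spine⊆ = λ v m → there (spine⊆ C v m)
  ; leaf-attached = attached
  ; degree = degree′
  ; spine⇒deg≥2 = spine⇒deg≥2′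
  ; deg≥2⇒spine = deg≥2⇒spine′
  }
  where
  nxs : x ∉ sp
  nxs m = nx (spine⊆ C x m)
  ne : ∀ {v} → v ∈ V' → x ≢ v
  ne m refl = nx m
  attached : ∀ v → v ∈ x ∷ V' → memb v sp ≡ false → memb (update att x y v) sp ≡ true
  attached v (here refl) e rewrite update-same att x y = ys
  attached v (there m) e rewrite update-other att x y (ne m) = leaf-attached C v m e
  adj-x : ∀ v → v ∈ V' → catAdj sp (update att x y) x v ≡ eqb y v
  adj-x v m = catAdj-fresh sp (update att x y) x y v nxs (update-same att x y) (attached v (there m))
  degree′ : ∀ v → v ∈ x ∷ V' → countOn (x ∷ V') (catAdj sp (update att x y) v) ≡ g v
  degree′ v (here refl) rewrite catAdj-irrefl sp (update att x y) x (spine-unique C) (attached x (here refl))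
                         | sumOn-cong V' (λ u m → cong bool→ℕ (adj-x u m)) | gx = countOn-eqb uV my
  degree′ v (there m) rewrite catAdj-sym sp (update att x y) v x | adj-x v m
                       | sumOn-cong V' (λ u m' → cong bool→ℕ (attachToSpine-old sp att x y v u (ne m) (ne m'))) | degree C v m
                       with v ≟ᶠ y
  ... | yes refl rewrite eqb-refl y = sym gy
  ... | no vy rewrite ≢⇒eqb-false y v (λ q → vy (sym q)) = sym (go v m vy)
  spine⇒deg≥2′ : ∀ v → v ∈ x ∷ V' → memb v sp ≡ true → 2 ≤ g v
  spine⇒deg≥2′ v (here refl) e = ⊥-elim (nxs (memb⇒∈ v sp e))
  spine⇒deg≥2′ v (there m) e with v ≟ᶠ y
  ... | yes refl = subst (2 ≤_) (sym gy) (≤-trans (spine⇒deg≥2 C v m e) (n≤1+n _))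
  ... | no vy = subst (2 ≤_) (sym (go v m vy)) (spine⇒deg≥2 C v m e)
  deg≥2⇒spine′ : ∀ v → v ∈ x ∷ V' → 2 ≤ g v → memb v sp ≡ true
  deg≥2⇒spine′ v (here refl) le with subst (2 ≤_) gx le
  ... | s≤s ()
  deg≥2⇒spine′ v (there m) le with v ≟ᶠ y
  ... | yes refl = ys
  ... | no vy = deg≥2⇒spine C v m (subst (2 ≤_) (go v m vy) le)

extendSpine-new : ∀ {n} (h : Fin n) (t : List (Fin n)) att (y v : Fin n) → y ∉ h ∷ t → att y ≡ h →
        (memb v (h ∷ t) ≡ false → memb (att v) (h ∷ t) ≡ true) →
        catAdj (y ∷ h ∷ t) att y v ≡ catAdj (h ∷ t) att y v
extendSpine-new {n} h t att y v ny ay attached = trans L (sym R)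
  where
  s : List (Fin n)
  s = h ∷ t
  nh : eqb h y ≡ false
  nh = ≢⇒eqb-false h y (λ q → ny (subst (_∈ s) q (here refl)))
  lv : (not (memb v s) ∧ eqb (att v) y) ≡ false
  lv = noLeafAt-offSpine s att v y attached ny
  R : catAdj s att y v ≡ eqb h v
  R rewrite spineAdj-∉ s v ny | ∉⇒memb-false y s ny | ay | lv = ∨-identityʳ (eqb h v)
  L : catAdj (y ∷ s) att y v ≡ eqb h v
  L with eqb y v in e
  ... | true rewrite eqb-refl y | consec-∉ˡ s v ny | consec-∉ʳ s v ny | nh = trans (∨-identityʳ²-∨ (eqb h v) refl) (∨-identityʳ (eqb h v))
  ... | false rewrite eqb-refl y | consec-∉ˡ s v ny | consec-∉ʳ s v ny = trans (∨-identityʳ²-∨ (eqb h v) lv) (∨-identityʳ (eqb h v))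

extendSpine-old : ∀ {n} (h : Fin n) (t : List (Fin n)) att (x y u v : Fin n) → y ∉ h ∷ t → att y ≡ h →
          (memb u (h ∷ t) ≡ false → memb (att u) (h ∷ t) ≡ true) →
          (memb v (h ∷ t) ≡ false → memb (att v) (h ∷ t) ≡ true) → x ≢ u → x ≢ v →
          catAdj (y ∷ h ∷ t) (update att x y) u v ≡ catAdj (h ∷ t) att u v
extendSpine-old h t att x y u v ny ay aSu aSv nu nv rewrite update-other att x y nu | update-other att x y nv with u ≟ᶠ y | v ≟ᶠ y
... | yes refl | _ = extendSpine-new h t att y v ny ay aSv
... | no uy | yes refl = trans (catAdj-sym (y ∷ h ∷ t) att u y) (trans (extendSpine-new h t att y u ny ay aSu) (catAdj-sym (h ∷ t) att y u))
... | no uy | no vy rewrite ≢⇒eqb-false y u (λ q → uy (sym q)) | ≢⇒eqb-false y v (λ q → vy (sym q)) = refl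

extendSpine : ∀ {n} {V' : List (Fin n)} {g' g : Fin n → ℕ} {h t att} (x y : Fin n) →
      Caterpillar V' g' (h ∷ t) att → Unique V' → x ∉ V' → y ∈ V' → memb y (h ∷ t) ≡ false → att y ≡ h →
      1 ≤ g' y → g x ≡ 1 → g y ≡ suc (g' y) → (∀ v → v ∈ V' → v ≢ y → g v ≡ g' v) →
      Caterpillar (x ∷ V') g (y ∷ h ∷ t) (update att x y)
extendSpine {n} {V'} {g'} {g} {h} {t} {att} x y C uV nx my ny ay g'y gx gy go = record
  { spine-unique = s'U
  ; spine⊆ = λ { v (here refl) → there my ; v (there m) → there (spine⊆ C v m) }
  ; leaf-attached = attached
  ; degree = degree′
  ; spine⇒deg≥2 = spine⇒deg≥2′
  ; deg≥2⇒spine = deg≥2⇒spine′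
  }
  where
  s s' : List (Fin n)
  s = h ∷ t
  s' = y ∷ h ∷ t
  att' : Fin n → Fin n
  att' = update att x y
  nyi : y ∉ s
  nyi = memb-false⇒∉ ny
  ne : ∀ {v} → v ∈ V' → x ≢ v
  ne m refl = nx m
  nxs : x ∉ s'
  nxs (here q) = nx (subst (_∈ V') (sym q) my)
  nxs (there m) = nx (spine⊆ C x m)
  attached : ∀ v → v ∈ x ∷ V' → memb v s' ≡ false → memb (att' v) s' ≡ true
  attached v (here refl) e rewrite update-same att x y | eqb-refl y = refl
  attached v (there m) e rewrite update-other att x y (ne m) with eqb y v
  attached v (there m) () | true
  ... | false = ∨-trueʳ (eqb y (att v)) (leaf-attached C v m e)
  adj-x : ∀ v → v ∈ V' → catAdj s' att' x v ≡ eqb y v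
  adj-x v m = catAdj-fresh s' att' x y v nxs (update-same att x y) (attached v (there m))
  degree′ : ∀ v → v ∈ x ∷ V' → countOn (x ∷ V') (catAdj s' att' v) ≡ g v
  s'U : Unique s'
  s'U = tabulate (λ m q → nyi (subst (_∈ s) (sym q) m)) ∷ spine-unique C
  degree′ v (here refl) rewrite catAdj-irrefl s' att' x s'U (attached x (here refl))
                         | sumOn-cong V' (λ u m → cong bool→ℕ (adj-x u m)) | gx = countOn-eqb uV my
  degree′ v (there m) rewrite catAdj-sym s' att' v x | adj-x v m
                       | sumOn-cong V' (λ u m' → cong bool→ℕ (extendSpine-old h t att x y v u nyi ay (leaf-attached C v m) (leaf-attached C u m') (ne m) (ne m'))) | degree C v m
                       with v ≟ᶠ y
  ... | yes refl rewrite eqb-refl y = sym gy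
  ... | no vy rewrite ≢⇒eqb-false y v (λ q → vy (sym q)) = sym (go v m vy)
  spine⇒deg≥2′ : ∀ v → v ∈ x ∷ V' → memb v s' ≡ true → 2 ≤ g v
  spine⇒deg≥2′ v (here refl) e = ⊥-elim (nxs (memb⇒∈ v s' e))
  spine⇒deg≥2′ v (there m) e with v ≟ᶠ y
  ... | yes refl = subst (2 ≤_) (sym gy) (s≤s g'y)
  ... | no vy rewrite ≢⇒eqb-false y v (λ q → vy (sym q)) = subst (2 ≤_) (sym (go v m vy)) (spine⇒deg≥2 C v m e)
  deg≥2⇒spine′ : ∀ v → v ∈ x ∷ V' → 2 ≤ g v → memb v s' ≡ true
  deg≥2⇒spine′ v (here refl) le with subst (2 ≤_) gx le
  ... | s≤s ()
  deg≥2⇒spine′ v (there m) le with v ≟ᶠ y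
  ... | yes refl rewrite eqb-refl y = refl
  ... | no vy rewrite ≢⇒eqb-false y v (λ q → vy (sym q)) = deg≥2⇒spine C v m (subst (2 ≤_) (go v m vy) le)

subdivide-leafTerm : ∀ {n} (s : List (Fin n)) att (x h ℓ u v : Fin n) → att ℓ ≡ h → ¬ (u ≡ ℓ × v ≡ h) → x ≢ v →
        (not (memb u s) ∧ eqb (update att ℓ x u) v) ≡ (not (memb u s) ∧ eqb (att u) v)
subdivide-leafTerm s att x h ℓ u v aℓ nuv nxv with u ≟ᶠ ℓ
... | yes refl rewrite update-same att u x | aℓ | ≢⇒eqb-false x v nxv | ≢⇒eqb-false h v (λ q → nuv (refl , sym q)) = refl
... | no uℓ rewrite update-other att ℓ x (λ q → uℓ (sym q)) = refl

subdivide-old : ∀ {n} (h : Fin n) (t : List (Fin n)) att (x ℓ u v : Fin n) → att ℓ ≡ h →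
          ¬ (u ≡ ℓ × v ≡ h) → ¬ (u ≡ h × v ≡ ℓ) → x ≢ u → x ≢ v →
          catAdj (x ∷ h ∷ t) (update att ℓ x) u v ≡ catAdj (h ∷ t) att u v
subdivide-old h t att x ℓ u v aℓ n1 n2 nu nv rewrite ≢⇒eqb-false x u nu | ≢⇒eqb-false x v nv =
  cong (spineAdj (h ∷ t) u v ∨_) (cong₂ _∨_ (subdivide-leafTerm (h ∷ t) att x h ℓ u v aℓ n1 nv)
                                        (subdivide-leafTerm (h ∷ t) att x h ℓ v u aℓ (λ { (a , b) → n2 (b , a) }) nu))

subdivide-removed : ∀ {n} (h : Fin n) (t : List (Fin n)) att (x ℓ : Fin n) → ℓ ∉ h ∷ t → x ≢ h → x ≢ ℓ →
         catAdj (x ∷ h ∷ t) (update att ℓ x) h ℓ ≡ false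
subdivide-removed h t att x ℓ nℓ nxh nxℓ rewrite ≢⇒eqb-false x h nxh | ≢⇒eqb-false x ℓ nxℓ | eqb-refl h
  | consec-∉ʳ (h ∷ t) h nℓ | consec-∉ˡ (h ∷ t) h nℓ | ∉⇒memb-false ℓ (h ∷ t) nℓ | update-same att ℓ x | ≢⇒eqb-false x h nxh = refl

subdivide-new : ∀ {n} (h : Fin n) (t : List (Fin n)) att (x ℓ v : Fin n) → ℓ ∉ h ∷ t → x ∉ h ∷ t → x ≢ v →
        (memb v (h ∷ t) ≡ false → memb (att v) (h ∷ t) ≡ true) →
        catAdj (x ∷ h ∷ t) (update att ℓ x) x v ≡ eqb h v ∨ eqb ℓ v
subdivide-new h t att x ℓ v nℓ nx nxv attached rewrite eqb-refl x | ≢⇒eqb-false x v nxv | consec-∉ˡ (h ∷ t) v nx | consec-∉ʳ (h ∷ t) v nx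
  = ∨-identityʳ²-∨ (eqb h v) Z
  where
  Z : (not (eqb h v ∨ memb v t) ∧ eqb (update att ℓ x v) x) ≡ eqb ℓ v
  Z with v ≟ᶠ ℓ
  ... | yes refl rewrite ∉⇒memb-false v (h ∷ t) nℓ | update-same att v x | eqb-refl x | eqb-refl v = refl
  ... | no vℓ rewrite update-other att ℓ x (λ q → vℓ (sym q)) | ≢⇒eqb-false ℓ v (λ q → vℓ (sym q)) = noLeafAt-offSpine (h ∷ t) att v x attached nx

subdivide : ∀ {n} {V' : List (Fin n)} {g' g : Fin n → ℕ} {h t att} (x ℓ : Fin n) →
      Caterpillar V' g' (h ∷ t) att → Unique V' → x ∉ V' → ℓ ∈ V' → memb ℓ (h ∷ t) ≡ false → att ℓ ≡ h →
      g x ≡ 2 → (∀ v → v ∈ V' → g v ≡ g' v) →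
      Caterpillar (x ∷ V') g (x ∷ h ∷ t) (update att ℓ x)
subdivide {n} {V'} {g'} {g} {h} {t} {att} x ℓ C uV nx mℓ nℓ aℓ gx go = record
  { spine-unique = s'U
  ; spine⊆ = λ { v (here refl) → here refl ; v (there m) → there (spine⊆ C v m) }
  ; leaf-attached = attached
  ; degree = degree′
  ; spine⇒deg≥2 = spine⇒deg≥2′
  ; deg≥2⇒spine = deg≥2⇒spine′
  }
  where
  s s' : List (Fin n)
  s = h ∷ t
  s' = x ∷ h ∷ t
  att' : Fin n → Fin n
  att' = update att ℓ x
  nℓi : ℓ ∉ s
  nℓi = memb-false⇒∉ nℓ
  nxs : x ∉ s
  nxs m = nx (spine⊆ C x m)
  s'U : Unique s'
  s'U = tabulate (λ m q → nxs (subst (_∈ s) (sym q) m)) ∷ spine-unique C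
  ne : ∀ {v} → v ∈ V' → x ≢ v
  ne m refl = nx m
  mh : h ∈ V'
  mh = spine⊆ C h (here refl)
  hℓ : h ≢ ℓ
  hℓ q = nℓi (subst (_∈ s) q (here refl))
  attached : ∀ v → v ∈ x ∷ V' → memb v s' ≡ false → memb (att' v) s' ≡ true
  attached v (here refl) e rewrite eqb-refl v with e
  ... | ()
  attached v (there m) e rewrite ≢⇒eqb-false x v (ne m) with v ≟ᶠ ℓ
  ... | yes refl rewrite update-same att v x | eqb-refl x = refl
  ... | no vℓ rewrite update-other att ℓ x (λ q → vℓ (sym q)) = ∨-trueʳ (eqb x (att v)) (leaf-attached C v m e)
  adj-x : ∀ v → v ∈ V' → catAdj s' att' v x ≡ eqb h v ∨ eqb ℓ v
  adj-x v m = trans (catAdj-sym s' att' v x) (subdivide-new h t att x ℓ v nℓi nxs (ne m) (leaf-attached C v m))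
  oldEq : ∀ u v → u ∈ V' → v ∈ V' → ¬ (u ≡ ℓ × v ≡ h) → ¬ (u ≡ h × v ≡ ℓ) → catAdj s' att' u v ≡ catAdj s att u v
  oldEq u v mu mv n1 n2 = subdivide-old h t att x ℓ u v aℓ n1 n2 (ne mu) (ne mv)
  hlF : catAdj s' att' h ℓ ≡ false
  hlF = subdivide-removed h t att x ℓ nℓi (ne mh) (ne mℓ)
  hlT : catAdj s att h ℓ ≡ true
  hlT rewrite ∉⇒memb-false ℓ s nℓi | aℓ | eqb-refl h = ∨-trueʳ (spineAdj s h ℓ) (∨-trueʳ (not (true ∨ memb h t) ∧ eqb (att h) ℓ) refl)
  traded : ∀ v w → v ∈ V' → w ∈ V' → catAdj s' att' v x ≡ true → catAdj s' att' v w ≡ false → catAdj s att v w ≡ true →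
           (∀ u → u ∈ remove w V' → catAdj s' att' v u ≡ catAdj s att v u) → countOn (x ∷ V') (catAdj s' att' v) ≡ g v
  traded v w mv mw e1 e2 e3 eq =
    trans (countOn-trade x w (catAdj s' att' v) (catAdj s att v) uV mw e1 e2 e3 eq) (trans (degree C v mv) (sym (go v mv)))
  degree′ : ∀ v → v ∈ x ∷ V' → countOn (x ∷ V') (catAdj s' att' v) ≡ g v
  degree′ v (here refl) rewrite catAdj-irrefl s' att' x s'U (attached x (here refl)) | gx =
    countOn≡2 (catAdj s' att' x) uV mh mℓ hℓ
      (trans (catAdj-sym s' att' x h) (trans (adj-x h mh) (cong (_∨ eqb ℓ h) (eqb-refl h))))
      (trans (catAdj-sym s' att' x ℓ) (trans (adj-x ℓ mℓ) (∨-trueʳ (eqb h ℓ) (eqb-refl ℓ))))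
      (λ u m uh uℓ → trans (catAdj-sym s' att' x u) (trans (adj-x u m) (∨-false (≢⇒eqb-false h u (λ q → uh (sym q))) (≢⇒eqb-false ℓ u (λ q → uℓ (sym q))))))
  degree′ v (there m) with v ≟ᶠ h
  ... | yes refl = traded v ℓ m mℓ (trans (adj-x v m) (cong (_∨ eqb ℓ v) (eqb-refl v))) hlF hlT
        (λ u m' → oldEq v u m (proj₁ (∈-remove⁻ V' m'))
             (λ { (a , _) → hℓ a }) (λ { (_ , b) → proj₂ (∈-remove⁻ V' m') b }))
  ... | no vh with v ≟ᶠ ℓ
  ... | yes refl = traded v h m mh (trans (adj-x v m) (∨-trueʳ (eqb h v) (eqb-refl v)))
        (trans (catAdj-sym s' att' v h) hlF) (trans (catAdj-sym s att v h) hlT)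
        (λ u m' → oldEq v u m (proj₁ (∈-remove⁻ V' m'))
             (λ { (_ , b) → proj₂ (∈-remove⁻ V' m') b }) (λ { (a , _) → vh a }))
  ... | no vℓ = trans (cong₂ _+_ (cong bool→ℕ (trans (adj-x v m) (∨-false (≢⇒eqb-false h v (λ q → vh (sym q))) (≢⇒eqb-false ℓ v (λ q → vℓ (sym q))))))
                                (sumOn-cong V' (λ u m' → cong bool→ℕ (oldEq v u m m' (λ { (a , _) → vℓ a }) (λ { (a , _) → vh a })))))
                 (trans (degree C v m) (sym (go v m)))
  spine⇒deg≥2′ : ∀ v → v ∈ x ∷ V' → memb v s' ≡ true → 2 ≤ g v
  spine⇒deg≥2′ v (here refl) e = subst (2 ≤_) (sym gx) ≤-refl
  spine⇒deg≥2′ v (there m) e rewrite ≢⇒eqb-false x v (ne m) = subst (2 ≤_) (sym (go v m)) (spine⇒deg≥2 C v m e)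
  deg≥2⇒spine′ : ∀ v → v ∈ x ∷ V' → 2 ≤ g v → memb v s' ≡ true
  deg≥2⇒spine′ v (here refl) le rewrite eqb-refl v = refl
  deg≥2⇒spine′ v (there m) le rewrite ≢⇒eqb-false x v (ne m) = deg≥2⇒spine C v m (subst (2 ≤_) (go v m) le)

countOn-all : ∀ {n} (V : List (Fin n)) {g : Fin n → Bool} → (∀ u → u ∈ V → g u ≡ true) → countOn V g ≡ length V
countOn-all V f = trans (sumOn-cong V (λ u m → cong bool→ℕ (f u m))) (sumOn-one V)

star : ∀ {n} {V : List (Fin n)} {g : Fin n → ℕ} (c : Fin n) → Unique V → c ∈ V →
       suc (g c) ≡ length V → 2 ≤ g c → (∀ v → v ∈ V → v ≢ c → g v ≡ 1) →
       Caterpillar V g (c ∷ []) (λ _ → c)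
star {n} {V} {g} c uV mc gc g2 go = record
  { spine-unique = [] ∷ []
  ; spine⊆ = λ { v (here refl) → mc }
  ; leaf-attached = λ v m e → cong (_∨ false) (eqb-refl c)
  ; degree = degree′
  ; spine⇒deg≥2 = spine⇒deg≥2′
  ; deg≥2⇒spine = deg≥2⇒spine′
  }
  where
  A : Fin n → Fin n → Bool
  A = catAdj (c ∷ []) (λ _ → c)
  degree′ : ∀ v → v ∈ V → countOn V (A v) ≡ g v
  degree′ v m with v ≟ᶠ c
  ... | yes refl = trans (sumOn-remove (λ u → bool→ℕ (A v u)) uV mc)
                    (trans (cong (λ z → bool→ℕ z + countOn (remove v V) (A v)) (trans (cong (λ z → (not (z ∨ false) ∧ z) ∨ (not (z ∨ false) ∧ z)) (eqb-refl v)) refl))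
                     (trans (countOn-all (remove v V) (λ u m' → fu u (proj₂ (∈-remove⁻ V m'))))
                       (suc-injective (trans (sym (length-remove uV mc)) (sym gc)))))
    where
    fu : ∀ u → u ≢ v → A v u ≡ true
    fu u uv rewrite eqb-refl v | ≢⇒eqb-false v u (λ q → uv (sym q)) = refl
  ... | no vc = trans (sumOn-cong V (λ u _ → cong bool→ℕ (fu u))) (trans (countOn-eqb uV mc) (sym (go v m vc)))
    where
    fu : ∀ u → A v u ≡ eqb c u
    fu u rewrite ≢⇒eqb-false c v (λ q → vc (sym q)) with eqb c u
    ... | true = refl
    ... | false = refl
  spine⇒deg≥2′ : ∀ v → v ∈ V → memb v (c ∷ []) ≡ true → 2 ≤ g v
  spine⇒deg≥2′ v m e with v ≟ᶠ c
  ... | yes refl = g2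
  ... | no vc rewrite ≢⇒eqb-false c v (λ q → vc (sym q)) with e
  ... | ()
  deg≥2⇒spine′ : ∀ v → v ∈ V → 2 ≤ g v → memb v (c ∷ []) ≡ true
  deg≥2⇒spine′ v m le with v ≟ᶠ c
  ... | yes refl rewrite eqb-refl v = refl
  ... | no vc with subst (2 ≤_) (go v m vc) le
  ... | s≤s ()

headLeaf : ∀ {n} {V : List (Fin n)} {g} {h h2 : Fin n} {t att} → Caterpillar V g (h ∷ h2 ∷ t) att → Unique V →
            Σ (Fin n) λ ℓ → ℓ ∈ V × memb ℓ (h ∷ h2 ∷ t) ≡ false × att ℓ ≡ h
headLeaf {V = V} {g} {h} {h2} {t} {att} C uV with countOn>length⇒∃∉ (catAdj (h ∷ h2 ∷ t) att h) (h2 ∷ []) uV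
     (subst (2 ≤_) (sym (degree C h (spine⊆ C h (here refl)))) (spine⇒deg≥2 C h (spine⊆ C h (here refl)) (cong (_∨ (eqb h2 h ∨ memb h t)) (eqb-refl h))))
... | u , mu , e , nm with ∨-true⁻ (spineAdj (h ∷ h2 ∷ t) h u) _ e
... | inj₁ e1 = ⊥-elim (eqb-false⇒≢ h2 u (trans (sym (∨-identityʳ _)) nm) (sym (spineAdj-head (spine-unique C) e1)))
... | inj₂ e2 with ∨-true⁻ (not (memb h (h ∷ h2 ∷ t)) ∧ eqb (att h) u) _ e2
... | inj₁ e3 = ⊥-elim (memb-false⇒∉ {v = h} {s = h ∷ h2 ∷ t} (not-true _ (∧-trueˡ _ _ e3)) (here refl))
headLeaf {V = V} {g} {h} {h2} {t} {att} C uV | u , mu , e , nm | inj₂ e2 | inj₂ e4 =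
  u , mu , not-true _ (∧-trueˡ _ _ e4) , eqb⇒≡ (att u) h (∧-trueʳ _ _ e4)

centreLeafAvoiding : ∀ {n} {V : List (Fin n)} {g} {c : Fin n} {att} → Caterpillar V g (c ∷ []) att → Unique V → (y : Fin n) →
            Σ (Fin n) λ ℓ → ℓ ∈ V × ℓ ≢ y × memb ℓ (c ∷ []) ≡ false × att ℓ ≡ c
centreLeafAvoiding {V = V} {g} {c} {att} C uV y with countOn>length⇒∃∉ (catAdj (c ∷ []) att c) (y ∷ []) uV
     (subst (2 ≤_) (sym (degree C c (spine⊆ C c (here refl)))) (spine⇒deg≥2 C c (spine⊆ C c (here refl)) (cong (_∨ false) (eqb-refl c))))
... | u , mu , e , nm with ∨-true⁻ (spineAdj (c ∷ []) c u) _ e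
... | inj₁ ()
... | inj₂ e2 with ∨-true⁻ (not (memb c (c ∷ [])) ∧ eqb (att c) u) _ e2
... | inj₁ e3 = ⊥-elim (memb-false⇒∉ {v = c} {s = c ∷ []} (not-true _ (∧-trueˡ _ _ e3)) (here refl))
centreLeafAvoiding {V = V} {g} {c} {att} C uV y | u , mu , e , nm | inj₂ e2 | inj₂ e4 =
  u , mu , (λ q → eqb-false⇒≢ y u (trans (sym (∨-identityʳ _)) nm) (sym q)) , not-true _ (∧-trueˡ _ _ e4) , eqb⇒≡ (att u) c (∧-trueʳ _ _ e4)

lowDegreeSpineVertex-isEnd : ∀ {n} {V : List (Fin n)} {g} {s : List (Fin n)} {att} {w y : Fin n} → Caterpillar V g s att → Unique V →
          w ∈ s → y ∈ V → memb y s ≡ false → att y ≡ w → g w ≤ 2 →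
          (Σ (List (Fin n)) λ t → s ≡ w ∷ t) ⊎ (Σ (List (Fin n)) λ r → reverse s ≡ w ∷ r)
lowDegreeSpineVertex-isEnd {V = V} {g} {s} {att} {w} {y} C uV mw my ny ay gw with spine-position (spine-unique C) mw
... | inj₁ p = inj₁ p
... | inj₂ (inj₁ p) = inj₂ p
... | inj₂ (inj₂ (a , b , ab , c₁ , c₂)) =
  ⊥-elim (<⇒≱ (s≤s gw) (subst (3 ≤_) (degree C w (spine⊆ C w mw))
    (countOn≥3 (catAdj s att w) uV (spine⊆ C a ma) (spine⊆ C b mb) my ab (λ q → nyi (subst (_∈ s) q ma)) (λ q → nyi (subst (_∈ s) q mb))
      (∨-trueˡ _ (∨-trueʳ (consec s w a) c₁)) (∨-trueˡ _ (∨-trueˡ _ c₂)) wy)))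
  where
  nyi : y ∉ s
  nyi = memb-false⇒∉ ny
  ma : a ∈ s
  ma = proj₁ (consec⇒∈ s c₁)
  mb : b ∈ s
  mb = proj₂ (consec⇒∈ s c₂)
  wy : catAdj s att w y ≡ true
  wy rewrite ny | ay | eqb-refl w = ∨-trueʳ (spineAdj s w y) (∨-trueʳ (not (memb w s) ∧ eqb (att w) y) refl)

linked-consec : ∀ {n} (P : Fin n → Fin n → Set) (r : List (Fin n)) → (∀ u v → consec r u v ≡ true → P u v) → Linked P r
linked-consec P [] f = []
linked-consec P (a ∷ []) f = [-]
linked-consec P (a ∷ b ∷ t) f = f a b (consec-head a b t) ∷ linked-consec P (b ∷ t) (λ u v e → f u v (consec-∷ a (b ∷ t) e))

catAdj-cases : ∀ {n} (s : List (Fin n)) att (u v : Fin n) → catAdj s att u v ≡ true →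
           consec s u v ≡ true ⊎ consec s v u ≡ true ⊎ (memb u s ≡ false × att u ≡ v) ⊎ (memb v s ≡ false × att v ≡ u)
catAdj-cases s att u v e with ∨-true⁻ (spineAdj s u v) _ e
... | inj₁ e1 with ∨-true⁻ (consec s u v) _ e1
... | inj₁ c = inj₁ c
... | inj₂ c = inj₂ (inj₁ c)
catAdj-cases s att u v e | inj₂ e2 with ∨-true⁻ (not (memb u s) ∧ eqb (att u) v) _ e2
... | inj₁ e3 = inj₂ (inj₂ (inj₁ (not-true _ (∧-trueˡ _ _ e3) , eqb⇒≡ _ _ (∧-trueʳ _ _ e3))))
... | inj₂ e4 = inj₂ (inj₂ (inj₂ (not-true _ (∧-trueˡ _ _ e4) , eqb⇒≡ _ _ (∧-trueʳ _ _ e4))))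

indexOf : ∀ {n} → Fin n → List (Fin n) → ℕ
indexOf v [] = 0
indexOf v (a ∷ t) = if eqb a v then 0 else suc (indexOf v t)

indexOf<length : ∀ {n} (v : Fin n) (s : List (Fin n)) → memb v s ≡ true → indexOf v s < length s
indexOf<length v [] ()
indexOf<length v (a ∷ t) e with eqb a v
... | true = s≤s z≤n
... | false = s≤s (indexOf<length v t e)

indexOf-consec : ∀ {n} {s : List (Fin n)} {u v : Fin n} → Unique s → consec s u v ≡ true → indexOf v s ≡ suc (indexOf u s)
indexOf-consec {s = []} _ ()
indexOf-consec {s = a ∷ []} _ ()
indexOf-consec {s = a ∷ b ∷ t} {u} {v} ((nab ∷ na) ∷ us) e with eqb a u in e1
... | true with eqb⇒≡ a u e1
... | refl with eqb b v in e2
... | true with eqb⇒≡ b v e2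
... | refl rewrite ≢⇒eqb-false a b nab | eqb-refl b | eqb-refl a = refl
indexOf-consec {s = a ∷ b ∷ t} {u} {v} ((nab ∷ na) ∷ us) e | true | refl | false =
  ⊥-elim (lookup (nab ∷ na) (proj₁ (consec⇒∈ (b ∷ t) e)) refl)
indexOf-consec {s = a ∷ b ∷ t} {u} {v} ((nab ∷ na) ∷ us) e | false with eqb a v in e3
... | true with eqb⇒≡ a v e3
... | refl = ⊥-elim (lookup (nab ∷ na) (proj₂ (consec⇒∈ (b ∷ t) e)) refl)
indexOf-consec {s = a ∷ b ∷ t} {u} {v} ((nab ∷ na) ∷ us) e | false | false = cong suc (indexOf-consec us e)

-- Caterpillars as graphs

module _ {n : ℕ} (G : Graph n) where

  Adj-sym : ∀ {u v} → Adj G u v → Adj G v u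
  Adj-sym {u} {v} a = trans (Graph.sym G v u) a

  Star⇒walk : ∀ {u v} → Star (Adj G) u v → Σ (List (Fin n)) λ w → IsWalk G (u ∷ w) × last (u ∷ w) ≡ just v
  Star⇒walk ε = [] , [-] , refl
  Star⇒walk (_◅_ {j = w} a p) with Star⇒walk p
  ... | l , lk , le = w ∷ l , a ∷ lk , le

  reachableFrom⇒connected : (r : Fin n) → (∀ w → Star (Adj G) r w) → Connected G
  reachableFrom⇒connected r path u v = Star⇒walk (Star.reverse Adj-sym (path u) ◅◅ path v)

last∈ : ∀ {A : Set} (a : A) r {l : A} → last (a ∷ r) ≡ just l → l ∈ a ∷ r
last∈ a [] refl = here refl
last∈ a (b ∷ r) e = there (last∈ b r e)

last-∷ʳ : ∀ {A : Set} (xs : List A) {x} → last (xs ∷ʳ x) ≡ just x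
last-∷ʳ [] = refl
last-∷ʳ (a ∷ []) = refl
last-∷ʳ (a ∷ b ∷ r) = last-∷ʳ (b ∷ r)

Unique-∷ʳ : ∀ {A : Set} (xs : List A) {x} → Unique xs → x ∉ xs → Unique (xs ∷ʳ x)
Unique-∷ʳ xs u x∉ = Unique.++⁺ u ([] ∷ []) λ { (m , here refl) → x∉ m }

Linked-∷ʳ : ∀ {A : Set} {R : A → A → Set} (xs : List A) {l x} →
            Linked R xs → last xs ≡ just l → R l x → Linked R (xs ∷ʳ x)
Linked-∷ʳ (a ∷ []) [-] refl r = r ∷ [-]
Linked-∷ʳ (a ∷ b ∷ r) (ab ∷ lk) e lx = ab ∷ Linked-∷ʳ (b ∷ r) lk e lx

-- A rank in which adjacent vertices differ and every vertex has at most one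
-- lower neighbour rules out cycles: along a cycle the rank can only go up
-- and then only down, which cannot close up.
module RankAcyclic {n : ℕ} (G : Graph n) (rank : Fin n → ℕ)
       (adj⇒rank≢ : ∀ u v → Adj G u v → rank u ≢ rank v)
       (lowerNeighbour-unique : ∀ u c b → Adj G u b → Adj G c b → rank u < rank b → rank c < rank b → u ≡ c)
       where

  _<ʳ_ : Fin n → Fin n → Set
  p <ʳ q = rank p < rank q

  ascend-step : ∀ a b c → Adj G a b → Adj G b c → a <ʳ b → a ≢ c → b <ʳ c
  ascend-step a b c ab bc a<b a≢c with <-cmp (rank b) (rank c)
  ... | tri< b<c _ _ = b<c
  ... | tri≈ _ b=c _ = ⊥-elim (adj⇒rank≢ b c bc b=c)
  ... | tri> _ _ c<b = ⊥-elim (a≢c (lowerNeighbour-unique a c b ab (Adj-sym G bc) a<b c<b))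

  descend-step : ∀ a b c → Adj G a b → Adj G b c → c <ʳ b → a ≢ c → b <ʳ a
  descend-step a b c ab bc c<b a≢c with <-cmp (rank a) (rank b)
  ... | tri> _ _ b<a = b<a
  ... | tri≈ _ a=b _ = ⊥-elim (adj⇒rank≢ a b ab a=b)
  ... | tri< a<b _ _ = ⊥-elim (a≢c (lowerNeighbour-unique a c b ab (Adj-sym G bc) a<b c<b))

  ascending : ∀ a b r → Unique (a ∷ b ∷ r) → Linked (Adj G) (a ∷ b ∷ r) → a <ʳ b → Linked _<ʳ_ (a ∷ b ∷ r)
  ascending a b [] _ _ a<b = a<b ∷ [-]
  ascending a b (c ∷ r) (a∉ ∷ u) (ab ∷ bc ∷ lk) a<b =
    a<b ∷ ascending b c r u (bc ∷ lk) (ascend-step a b c ab bc a<b (lookup a∉ (there (here refl))))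

  EndsDescending : List (Fin n) → Set
  EndsDescending [] = ⊥
  EndsDescending (a ∷ []) = ⊥
  EndsDescending (a ∷ b ∷ []) = b <ʳ a
  EndsDescending (a ∷ b ∷ c ∷ r) = EndsDescending (b ∷ c ∷ r)

  descending : ∀ a b r → Unique (a ∷ b ∷ r) → Linked (Adj G) (a ∷ b ∷ r) → EndsDescending (a ∷ b ∷ r) →
               b <ʳ a × (∀ {l} → last (a ∷ b ∷ r) ≡ just l → l <ʳ a)
  descending a b [] _ _ b<a = b<a , λ { refl → b<a }
  descending a b (c ∷ r) (a∉ ∷ u) (ab ∷ bc ∷ lk) end with descending b c r u (bc ∷ lk) end
  ... | c<b , l<b = b<a , λ e → <-trans (l<b e) b<a
    where
    b<a : b <ʳ a
    b<a = descend-step a b c ab bc c<b (lookup a∉ (there (here refl)))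

  EndsDescending-∷ʳ : ∀ a b r {l x} → last (a ∷ b ∷ r) ≡ just l → x <ʳ l → EndsDescending ((a ∷ b ∷ r) ∷ʳ x)
  EndsDescending-∷ʳ a b [] refl x<l = x<l
  EndsDescending-∷ʳ a b (c ∷ r) e x<l = EndsDescending-∷ʳ b c r e x<l

  ascending-head<last : ∀ a b r {l} → Linked _<ʳ_ (a ∷ b ∷ r) → last (a ∷ b ∷ r) ≡ just l → a <ʳ l
  ascending-head<last a b [] (a<b ∷ _) refl = a<b
  ascending-head<last a b (c ∷ r) (a<b ∷ lk) e = <-trans a<b (ascending-head<last b c r lk e)

  ascending-lastStep : ∀ a b r {l} → Linked (Adj G) (a ∷ b ∷ r) → Linked _<ʳ_ (a ∷ b ∷ r) →
                       last (a ∷ b ∷ r) ≡ just l → Σ (Fin n) λ p → p ∈ a ∷ b ∷ r × Adj G p l × p <ʳ l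
  ascending-lastStep a b [] (ab ∷ _) (a<b ∷ _) refl = a , here refl , ab , a<b
  ascending-lastStep a b (c ∷ r) (_ ∷ lk) (_ ∷ lr) e with ascending-lastStep b c r lk lr e
  ... | p , p∈ , pl , p<l = p , there p∈ , pl , p<l

  no-ascending-cycle : ∀ x y z rest {l} → Unique (x ∷ y ∷ z ∷ rest) → Linked (Adj G) (x ∷ y ∷ z ∷ rest) →
                       last (x ∷ y ∷ z ∷ rest) ≡ just l → Adj G l x → x <ʳ y → ⊥
  no-ascending-cycle x y z rest {l} uL lk@(_ ∷ lk′) le lx x<y
    with ascending x y (z ∷ rest) uL lk x<y
  ... | up@(_ ∷ up′) with ascending-lastStep y z rest lk′ up′ le
  ... | p , p∈ , pl , p<l =
    lookup (AllPairs.head uL) p∈ (sym (lowerNeighbour-unique p x l pl (Adj-sym G lx) p<l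
                                          (ascending-head<last x y (z ∷ rest) up le)))

  no-descending-cycle : ∀ x y z rest {l} → Unique (x ∷ y ∷ z ∷ rest) → Linked (Adj G) (x ∷ y ∷ z ∷ rest) →
                        last (x ∷ y ∷ z ∷ rest) ≡ just l → Adj G l x → y <ʳ x → x <ʳ l → ⊥
  no-descending-cycle x y z rest {l} (x∉ ∷ uL) (_ ∷ lk) le lx y<x x<l =
    <⇒≱ y<x (<⇒≤ (proj₂ (descending y z (rest ∷ʳ x) uM lM (EndsDescending-∷ʳ y z rest le x<l)) (last-∷ʳ (y ∷ z ∷ rest))))
    where
    uM : Unique ((y ∷ z ∷ rest) ∷ʳ x)
    uM = Unique-∷ʳ (y ∷ z ∷ rest) uL (λ m → lookup x∉ m refl)
    lM : Linked (Adj G) ((y ∷ z ∷ rest) ∷ʳ x)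
    lM = Linked-∷ʳ (y ∷ z ∷ rest) lk le lx

  no-peak-cycle : ∀ x y z rest {l} → Unique (x ∷ y ∷ z ∷ rest) → Linked (Adj G) (x ∷ y ∷ z ∷ rest) →
                  last (x ∷ y ∷ z ∷ rest) ≡ just l → Adj G l x → y <ʳ x → l <ʳ x → ⊥
  no-peak-cycle x y z rest {l} (_ ∷ y∉ ∷ _) (xy ∷ _) le lx y<x l<x =
    lookup y∉ (last∈ z rest le) (lowerNeighbour-unique y l x (Adj-sym G xy) lx y<x l<x)

  acyclic : Acyclic G
  acyclic (x , y , z , rest , l , uL , lk@(xy ∷ _) , le , lx) with <-cmp (rank x) (rank y)
  ... | tri≈ _ x=y _ = adj⇒rank≢ x y xy x=y
  ... | tri< x<y _ _ = no-ascending-cycle x y z rest uL lk le lx x<y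
  ... | tri> _ _ y<x with <-cmp (rank l) (rank x)
  ...   | tri≈ _ l=x _ = adj⇒rank≢ l x lx l=x
  ...   | tri< l<x _ _ = no-peak-cycle x y z rest uL lk le lx y<x l<x
  ...   | tri> _ _ x<l = no-descending-cycle x y z rest uL lk le lx y<x x<l

module CaterpillarGraph {n : ℕ} {g : Fin n → ℕ} {s : List (Fin n)} {att : Fin n → Fin n}
                        (C : Caterpillar (allFin n) g s att) where

  graph : Graph n
  graph = record { adj = catAdj s att ; sym = catAdj-sym s att
                 ; irref = λ i → catAdj-irrefl s att i (spine-unique C) (leaf-attached C i (∈-allFin i)) }

  realizes : Realizes graph g
  realizes i = degree C i (∈-allFin i)

  rank : Fin n → ℕ
  rank v = if memb v s then indexOf v s else length s

  rank-spine : ∀ v → memb v s ≡ true → rank v ≡ indexOf v s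
  rank-spine v e rewrite e = refl

  rank-leaf : ∀ v → memb v s ≡ false → rank v ≡ length s
  rank-leaf v e rewrite e = refl

  rank-spine< : ∀ v → memb v s ≡ true → rank v < length s
  rank-spine< v e rewrite e = indexOf<length v s e

  rank-consec : ∀ {u v} → consec s u v ≡ true → rank v ≡ suc (rank u)
  rank-consec {u} {v} c = begin
    rank v             ≡⟨ rank-spine v (∈⇒memb (proj₂ (consec⇒∈ s c))) ⟩
    indexOf v s        ≡⟨ indexOf-consec (spine-unique C) c ⟩
    suc (indexOf u s)  ≡⟨ cong suc (rank-spine u (∈⇒memb (proj₁ (consec⇒∈ s c)))) ⟨
    suc (rank u)       ∎
    where open ≡-Reasoning

  rank-attach : ∀ u → memb u s ≡ false → rank (att u) < rank u
  rank-attach u e = subst (rank (att u) <_) (sym (rank-leaf u e)) (rank-spine< (att u) (leaf-attached C u (∈-allFin u) e))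

  adj⇒rank≢ : ∀ u v → Adj graph u v → rank u ≢ rank v
  adj⇒rank≢ u v e with catAdj-cases s att u v e
  ... | inj₁ c = λ q → 1+n≢n (trans (sym (rank-consec c)) (sym q))
  ... | inj₂ (inj₁ c) = λ q → 1+n≢n (trans (sym (rank-consec c)) q)
  ... | inj₂ (inj₂ (inj₁ (m , refl))) = λ q → <⇒≢ (rank-attach u m) (sym q)
  ... | inj₂ (inj₂ (inj₂ (m , refl))) = λ q → <⇒≢ (rank-attach v m) q

  lowerNeighbour : ∀ u b → Adj graph u b → rank u < rank b → consec s u b ≡ true ⊎ (memb b s ≡ false × att b ≡ u)
  lowerNeighbour u b e u<b with catAdj-cases s att u b e
  ... | inj₁ c = inj₁ c
  ... | inj₂ (inj₁ c) = ⊥-elim (<⇒≱ u<b (≤-trans (n≤1+n _) (≤-reflexive (sym (rank-consec c)))))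
  ... | inj₂ (inj₂ (inj₁ (m , refl))) = ⊥-elim (<⇒≱ u<b (<⇒≤ (rank-attach u m)))
  ... | inj₂ (inj₂ (inj₂ p)) = inj₂ p

  lowerNeighbour-unique : ∀ u c b → Adj graph u b → Adj graph c b → rank u < rank b → rank c < rank b → u ≡ c
  lowerNeighbour-unique u c b e1 e2 u<b c<b with lowerNeighbour u b e1 u<b | lowerNeighbour c b e2 c<b
  ... | inj₁ x | inj₁ y = consec-pred-unique (spine-unique C) x y
  ... | inj₂ (_ , p) | inj₂ (_ , q) = trans (sym p) q
  ... | inj₁ x | inj₂ (m , _) = ⊥-elim (memb-false⇒∉ m (proj₂ (consec⇒∈ s x)))
  ... | inj₂ (m , _) | inj₁ y = ⊥-elim (memb-false⇒∉ m (proj₂ (consec⇒∈ s y)))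

  open RankAcyclic graph rank adj⇒rank≢ lowerNeighbour-unique using (acyclic)

  spine-linked : Linked (Adj graph) s
  spine-linked = linked-consec (Adj graph) s (λ u v c → ∨-trueˡ _ (∨-trueˡ _ c))

  attach-adj : ∀ v → memb v s ≡ false → Adj graph (att v) v
  attach-adj v e = Adj-sym graph
    (∨-trueʳ (spineAdj s v (att v)) (∨-trueˡ _ (cong₂ _∧_ (cong not e) (eqb-refl (att v)))))

  path-along : ∀ a r v → Linked (Adj graph) (a ∷ r) → v ∈ a ∷ r → Star (Adj graph) a v
  path-along a r v lk (here refl) = ε
  path-along a (b ∷ r) v (ab ∷ lk) (there m) = ab ◅ path-along b r v lk m

  path-from-head : ∀ h t → s ≡ h ∷ t → ∀ w → Star (Adj graph) h w
  path-from-head h t refl w with memb w s in e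
  ... | true = path-along h t w spine-linked (memb⇒∈ w s e)
  ... | false = path-along h t (att w) spine-linked (memb⇒∈ (att w) s (leaf-attached C w (∈-allFin w) e))
                ◅◅ attach-adj w e ◅ ε

  spine-nonempty : ∀ {v} → v ∈ s → Σ (Fin n) λ h → Σ (List (Fin n)) λ t → s ≡ h ∷ t
  spine-nonempty (here {x = h} {xs = t} _) = h , t , refl
  spine-nonempty (there {x = h} {xs = t} _) = h , t , refl

  connected : Connected graph
  connected u with memb u s in e
  ... | true  = let h , t , s≡ = spine-nonempty (memb⇒∈ u s e) in
                reachableFrom⇒connected graph h (path-from-head h t s≡) u
  ... | false = let h , t , s≡ = spine-nonempty (memb⇒∈ (att u) s (leaf-attached C u (∈-allFin u) e)) in
                reachableFrom⇒connected graph h (path-from-head h t s≡) u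

  isCaterpillar : IsCaterpillar graph
  isCaterpillar = (connected , acyclic) , s , spine-unique C , spine-linked ,
    λ v → mk⇔ (λ m → subst (2 ≤_) (sym (realizes v)) (spine⇒deg≥2 C v (∈-allFin v) (∈⇒memb m)))
              (λ le → memb⇒∈ v s (deg≥2⇒spine C v (∈-allFin v) (subst (2 ≤_) (realizes v) le)))

-- Adding one vertex to a pair of edge-disjoint caterpillars

EdgeDisjointOn : ∀ {n} → List (Fin n) → List (Fin n) → (Fin n → Fin n) → List (Fin n) → (Fin n → Fin n) → Set
EdgeDisjointOn V s₁ a₁ s₂ a₂ = ∀ u v → u ∈ V → v ∈ V → catAdj s₁ a₁ u v ≡ true → catAdj s₂ a₂ u v ≡ true → ⊥

record ExtensionAt {n} (V' : List (Fin n)) (x y : Fin n) (g : Fin n → ℕ) (s : List (Fin n)) (a : Fin n → Fin n) : Set where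
  field
    spine : List (Fin n)
    attach : Fin n → Fin n
    cat : Caterpillar (x ∷ V') g spine attach
    fresh : ∀ v → v ∈ x ∷ V' → catAdj spine attach x v ≡ true → v ≡ y
    old : ∀ u v → u ∈ V' → v ∈ V' → catAdj spine attach u v ≡ true → catAdj s a u v ≡ true

record ExtensionAvoiding {n} (V' : List (Fin n)) (x y : Fin n) (g : Fin n → ℕ) (s : List (Fin n)) (a : Fin n → Fin n) : Set where
  field
    spine : List (Fin n)
    attach : Fin n → Fin n
    cat : Caterpillar (x ∷ V') g spine attach
    fresh : ∀ v → v ∈ x ∷ V' → catAdj spine attach x v ≡ true → v ≢ y
    old : ∀ u v → u ∈ V' → v ∈ V' → catAdj spine attach u v ≡ true → catAdj s a u v ≡ true

EdgeDisjointOn-extend : ∀ {n} {V' : List (Fin n)} {x y g₁ g₂ s₁ a₁ s₂ a₂} → EdgeDisjointOn V' s₁ a₁ s₂ a₂ →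
                        (E₁ : ExtensionAt V' x y g₁ s₁ a₁) → (E₂ : ExtensionAvoiding V' x y g₂ s₂ a₂) →
                        EdgeDisjointOn (x ∷ V') (ExtensionAt.spine E₁) (ExtensionAt.attach E₁)
                                                (ExtensionAvoiding.spine E₂) (ExtensionAvoiding.attach E₂)
EdgeDisjointOn-extend D E₁ E₂ u v (here refl) mv e₁ e₂ = ExtensionAvoiding.fresh E₂ v mv e₂ (ExtensionAt.fresh E₁ v mv e₁)
EdgeDisjointOn-extend D E₁ E₂ u v (there mu) (here refl) e₁ e₂ =
  ExtensionAvoiding.fresh E₂ u (there mu)
    (trans (catAdj-sym (ExtensionAvoiding.spine E₂) (ExtensionAvoiding.attach E₂) v u) e₂)
    (ExtensionAt.fresh E₁ u (there mu) (trans (catAdj-sym (ExtensionAt.spine E₁) (ExtensionAt.attach E₁) v u) e₁))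
EdgeDisjointOn-extend D E₁ E₂ u v (there mu) (there mv) e₁ e₂ =
  D u v mu mv (ExtensionAt.old E₁ u v mu mv e₁) (ExtensionAvoiding.old E₂ u v mu mv e₂)

EdgeDisjointOn-swap : ∀ {n} {V : List (Fin n)} {s₁ a₁ s₂ a₂} → EdgeDisjointOn V s₁ a₁ s₂ a₂ → EdgeDisjointOn V s₂ a₂ s₁ a₁
EdgeDisjointOn-swap D u v mu mv e₁ e₂ = D u v mu mv e₂ e₁

EdgeDisjointOn-⊆ : ∀ {n} {V W : List (Fin n)} {s₁ a₁ s₂ a₂} → EdgeDisjointOn V s₁ a₁ s₂ a₂ →
                   (∀ v → v ∈ W → v ∈ V) → EdgeDisjointOn W s₁ a₁ s₂ a₂
EdgeDisjointOn-⊆ D WV u v mu mv = D u v (WV u mu) (WV v mv)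

∈-unremove : ∀ {n} {V : List (Fin n)} {x : Fin n} → x ∈ V → ∀ v → v ∈ V → v ∈ x ∷ remove x V
∈-unremove {V = V} {x} mx v m with v ≟ᶠ x
... | yes refl = here refl
... | no ne = there (∈-remove⁺ V m ne)

Caterpillar-unremove : ∀ {n} {V : List (Fin n)} {x : Fin n} {g s a} → Unique V → x ∈ V →
                       Caterpillar (x ∷ remove x V) g s a → Caterpillar V g s a
Caterpillar-unremove {V = V} uV mx C = Caterpillar-transport C (∈-unremove mx)
  (λ { v (here refl) → mx ; v (there m) → proj₁ (∈-remove⁻ V m) })
  (λ k → sumOn-remove (λ u → bool→ℕ (k u)) uV mx)
  (λ _ _ → refl)

subdivideAvoiding : ∀ {n} {V' : List (Fin n)} {f : Fin n → ℕ} {h t a} (x y ℓ : Fin n) →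
          Caterpillar V' f (h ∷ t) a → Unique V' → x ∉ V' → ℓ ∈ V' → memb ℓ (h ∷ t) ≡ false → a ℓ ≡ h →
          h ≢ y → ℓ ≢ y → f x ≡ 2 → ExtensionAvoiding V' x y f (h ∷ t) a
subdivideAvoiding {V' = V'} {f} {h} {t} {a} x y ℓ C uV nx mℓ nℓ aℓ hy ℓy fx = record
  { spine = x ∷ h ∷ t ; attach = update a ℓ x ; cat = D ; fresh = fr ; old = od }
  where
  D : Caterpillar (x ∷ V') f (x ∷ h ∷ t) (update a ℓ x)
  D = subdivide x ℓ C uV nx mℓ nℓ aℓ fx (λ _ _ → refl)
  nxs : x ∉ h ∷ t
  nxs m = nx (spine⊆ C x m)
  ne : ∀ {v} → v ∈ V' → x ≢ v
  ne m refl = nx m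
  fr : ∀ v → v ∈ x ∷ V' → catAdj (x ∷ h ∷ t) (update a ℓ x) x v ≡ true → v ≢ y
  fr v (here refl) e with trans (sym e) (catAdj-irrefl (x ∷ h ∷ t) (update a ℓ x) v (spine-unique D) (leaf-attached D v (here refl)))
  ... | ()
  fr v (there m) e with ∨-true⁻ (eqb h v) (eqb ℓ v) (trans (sym (subdivide-new h t a x ℓ v (memb-false⇒∉ nℓ) nxs (ne m) (leaf-attached C v m))) e)
  ... | inj₁ q = λ vy → hy (trans (eqb⇒≡ h v q) vy)
  ... | inj₂ q = λ vy → ℓy (trans (eqb⇒≡ ℓ v q) vy)
  hlF : catAdj (x ∷ h ∷ t) (update a ℓ x) h ℓ ≡ false
  hlF = subdivide-removed h t a x ℓ (memb-false⇒∉ nℓ) (ne (spine⊆ C h (here refl))) (ne mℓ)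
  od : ∀ u v → u ∈ V' → v ∈ V' → catAdj (x ∷ h ∷ t) (update a ℓ x) u v ≡ true → catAdj (h ∷ t) a u v ≡ true
  od u v mu mv e with (u ≟ᶠ h) ×-dec (v ≟ᶠ ℓ) | (u ≟ᶠ ℓ) ×-dec (v ≟ᶠ h)
  ... | yes (refl , refl) | _ with trans (sym e) hlF
  ... | ()
  od u v mu mv e | no _ | yes (refl , refl) with trans (sym e) (trans (catAdj-sym (x ∷ h ∷ t) (update a ℓ x) u v) hlF)
  ... | ()
  od u v mu mv e | no n1 | no n2 = trans (sym (subdivide-old h t a x ℓ u v aℓ n2 n1 (ne mu) (ne mv))) e

offSpine⇒deg≤1 : ∀ {n} {V : List (Fin n)} {g s a} → Caterpillar V g s a → ∀ v → v ∈ V → memb v s ≡ false → g v ≤ 1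
offSpine⇒deg≤1 C v m e with 2 ≤? _
... | yes le with trans (sym e) (deg≥2⇒spine C v m le)
... | ()
offSpine⇒deg≤1 C v m e | no nle = ≤-pred (≰⇒> nle)

HeadTouches : ∀ {n} (y h : Fin n) (s : List (Fin n)) (a : Fin n → Fin n) → Set
HeadTouches y h s a = (y ≡ h) ⊎ (memb y s ≡ false × a y ≡ h)

headTouches? : ∀ {n} (y h : Fin n) (s : List (Fin n)) (a : Fin n → Fin n) → Dec (HeadTouches y h s a)
headTouches? y h s a with y ≟ᶠ h
... | yes q = yes (inj₁ q)
... | no yh with memb y s in e
... | true = no (λ { (inj₁ q) → yh q ; (inj₂ (() , _)) })
... | false with a y ≟ᶠ h
... | yes q = yes (inj₂ (refl , q))
... | no nq = no (λ { (inj₁ q) → yh q ; (inj₂ (_ , q)) → nq q })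

insertAvoiding-headFree : ∀ {n} {V' : List (Fin n)} {f : Fin n → ℕ} {h h2 t a} (x y : Fin n) →
                          Caterpillar V' f (h ∷ h2 ∷ t) a → Unique V' → x ∉ V' → y ∈ V' →
          f x ≡ 2 → ¬ HeadTouches y h (h ∷ h2 ∷ t) a → ExtensionAvoiding V' x y f (h ∷ h2 ∷ t) a
insertAvoiding-headFree {h = h} {h2} {t} {a = a} x y C uV nx my fx nb with headLeaf C uV
... | ℓ , mℓ , nℓ , aℓ = subdivideAvoiding x y ℓ C uV nx mℓ nℓ aℓ (λ q → nb (inj₁ (sym q)))
        (λ q → nb (inj₂ (subst (λ z → memb z (h ∷ h2 ∷ t) ≡ false) q nℓ , subst (λ z → a z ≡ h) q aℓ))) fx

insertAvoiding-headTouched : ∀ {n} {V' : List (Fin n)} {f : Fin n → ℕ} {h h2 t a} (x y : Fin n) →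
                             Caterpillar V' f (h ∷ h2 ∷ t) a → Unique V' → x ∉ V' → y ∈ V' →
         f x ≡ 2 → HeadTouches y h (h ∷ h2 ∷ t) a → ExtensionAvoiding V' x y f (h ∷ h2 ∷ t) a
insertAvoiding-headTouched {n} {V'} {f} {h} {h2} {t} {a} x y C uV nx my fx b with reverseAcc-shape t h2 h []
... | p , q , r , e , pm = record { spine = ExtensionAvoiding.spine E ; attach = ExtensionAvoiding.attach E ; cat = ExtensionAvoiding.cat E ; fresh = ExtensionAvoiding.fresh E
                                    ; old = λ u v mu mv z → trans (conv u v) (ExtensionAvoiding.old E u v mu mv z) }
  where
  s : List (Fin n)
  s = h ∷ h2 ∷ t
  Cr : Caterpillar V' f (p ∷ q ∷ r) a
  Cr = subst (λ z → Caterpillar V' f z a) e (Caterpillar-reverse C)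
  p∈s : p ∈ s
  p∈s = ∈-reverse⁻ (subst (p ∈_) (sym e) (here refl))
  ph : p ≢ h
  ph pq = lookup (hd (spine-unique C)) (p∈tl pm) (sym pq)
    where
    hd : Unique s → All (h ≢_) (h2 ∷ t)
    hd (z ∷ _) = z
    p∈tl : (p ≡ h2 ⊎ p ∈ t) → p ∈ h2 ∷ t
    p∈tl (inj₁ refl) = here refl
    p∈tl (inj₂ m) = there m
  conv : ∀ u v → catAdj s a u v ≡ catAdj (p ∷ q ∷ r) a u v
  conv u v = trans (sym (catAdj-reverse s a u v)) (cong (λ z → catAdj z a u v) e)
  memb-conv : ∀ v → memb v (p ∷ q ∷ r) ≡ memb v s
  memb-conv v = trans (cong (memb v) (sym e)) (memb-reverse v s)
  ℓ : Fin n
  ℓ = proj₁ (headLeaf Cr uV)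
  mℓ : ℓ ∈ V'
  mℓ = proj₁ (proj₂ (headLeaf Cr uV))
  nℓ : memb ℓ (p ∷ q ∷ r) ≡ false
  nℓ = proj₁ (proj₂ (proj₂ (headLeaf Cr uV)))
  aℓ : a ℓ ≡ p
  aℓ = proj₂ (proj₂ (proj₂ (headLeaf Cr uV)))
  ℓy : ℓ ≢ y
  ℓy q = bb (subst (λ z → HeadTouches z h s a) (sym q) b)
    where
    bb : HeadTouches ℓ h s a → ⊥
    bb (inj₁ e') = memb-false⇒∉ (trans (sym (memb-conv ℓ)) nℓ) (subst (_∈ s) (sym e') (here refl))
    bb (inj₂ (_ , ah)) = ph (trans (sym aℓ) ah)
  py : p ≢ y
  py q = bb (subst (λ z → HeadTouches z h s a) (sym q) b)
    where
    bb : HeadTouches p h s a → ⊥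
    bb (inj₁ q') = ph q'
    bb (inj₂ (m , _)) = memb-false⇒∉ m p∈s
  E : ExtensionAvoiding V' x y f (p ∷ q ∷ r) a
  E = subdivideAvoiding x y ℓ Cr uV nx mℓ nℓ aℓ py ℓy fx

insertAvoiding : ∀ {n} {V' : List (Fin n)} {f : Fin n → ℕ} {s a} (x y : Fin n) → Caterpillar V' f s a → Unique V' → x ∉ V' → y ∈ V' →
      ((∀ v → v ∈ V' → v ≢ y → f v ≤ 1) → ⊥) → f x ≡ 2 → ExtensionAvoiding V' x y f s a
insertAvoiding {s = []} x y C uV nx my NS fx with leaf-attached C y my refl
... | ()
insertAvoiding {f = f} {s = c ∷ []} {a} x y C uV nx my NS fx with y ≟ᶠ c
... | yes refl = ⊥-elim (NS (λ v m ne → offSpine⇒deg≤1 C v m (∨-false (≢⇒eqb-false y v (λ q → ne (sym q))) refl)))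
... | no yc with centreLeafAvoiding C uV y
... | ℓ , mℓ , ℓy , nℓ , aℓ = subdivideAvoiding x y ℓ C uV nx mℓ nℓ aℓ (λ q → yc (sym q)) ℓy fx
insertAvoiding {s = h ∷ h2 ∷ t} {a} x y C uV nx my NS fx with headTouches? y h (h ∷ h2 ∷ t) a
... | yes b = insertAvoiding-headTouched x y C uV nx my fx b
... | no nb = insertAvoiding-headFree x y C uV nx my fx nb

attachAtSpine : ∀ {n} {V' : List (Fin n)} {g' g : Fin n → ℕ} {s a} (x y : Fin n) →
        Caterpillar V' g' s a → Unique V' → x ∉ V' → y ∈ V' → memb y s ≡ true →
        g x ≡ 1 → g y ≡ suc (g' y) → (∀ v → v ∈ V' → v ≢ y → g v ≡ g' v) → ExtensionAt V' x y g s a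
attachAtSpine {V' = V'} {g = g} {s} {a} x y C uV nx my ys gx gy go = record
  { spine = s ; attach = update a x y ; cat = D
  ; fresh = λ v mv e → sym (eqb⇒≡ y v (trans (sym (catAdj-fresh s (update a x y) x y v nxs (update-same a x y) (leaf-attached D v mv))) e))
  ; old = λ u v mu mv e → trans (sym (attachToSpine-old s a x y u v (ne mu) (ne mv))) e }
  where
  D : Caterpillar (x ∷ V') g s (update a x y)
  D = attachToSpine x y C uV nx my ys gx gy go
  nxs : x ∉ s
  nxs m = nx (spine⊆ C x m)
  ne : ∀ {v} → v ∈ _ → x ≢ v
  ne m refl = nx m

attachAtSpineEnd : ∀ {n} {V' : List (Fin n)} {g' g : Fin n → ℕ} {h t a} (x y : Fin n) →
        Caterpillar V' g' (h ∷ t) a → Unique V' → x ∉ V' → y ∈ V' → memb y (h ∷ t) ≡ false → a y ≡ h →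
        1 ≤ g' y → g x ≡ 1 → g y ≡ suc (g' y) → (∀ v → v ∈ V' → v ≢ y → g v ≡ g' v) → ExtensionAt V' x y g (h ∷ t) a
attachAtSpineEnd {V' = V'} {g = g} {h} {t} {a} x y C uV nx my ny ay g1 gx gy go = record
  { spine = y ∷ h ∷ t ; attach = update a x y ; cat = D
  ; fresh = λ v mv e → sym (eqb⇒≡ y v (trans (sym (catAdj-fresh (y ∷ h ∷ t) (update a x y) x y v nxs (update-same a x y) (leaf-attached D v mv))) e))
  ; old = λ u v mu mv e → trans (sym (extendSpine-old h t a x y u v (memb-false⇒∉ ny) ay (leaf-attached C u mu) (leaf-attached C v mv) (ne mu) (ne mv))) e }
  where
  D : Caterpillar (x ∷ V') g (y ∷ h ∷ t) (update a x y)
  D = extendSpine x y C uV nx my ny ay g1 gx gy go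
  ne : ∀ {v} → v ∈ V' → x ≢ v
  ne m refl = nx m
  nxs : x ∉ y ∷ h ∷ t
  nxs (here q) = ne my q
  nxs (there m) = nx (spine⊆ C x m)

ExtensionAt-cong : ∀ {n} {V' : List (Fin n)} {x y g s a s0 a0} → (∀ u v → catAdj s a u v ≡ catAdj s0 a0 u v) →
            ExtensionAt V' x y g s a → ExtensionAt V' x y g s0 a0
ExtensionAt-cong eq E = record { spine = ExtensionAt.spine E ; attach = ExtensionAt.attach E ; cat = ExtensionAt.cat E ; fresh = ExtensionAt.fresh E
                        ; old = λ u v mu mv e → trans (sym (eq u v)) (ExtensionAt.old E u v mu mv e) }

-- Tree degree sequences and the induction on the number of vertices

-- The tree condition Σ d = 2|V| − 2 is kept in the form Σ d + 2 = |V| + |V|, free of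
-- truncated subtraction.
record TreeSeqPair {n} (V : List (Fin n)) (d f : Fin n → ℕ) : Set where
  field
    unique : Unique V
    d≥1 : ∀ v → v ∈ V → 1 ≤ d v
    f≥1 : ∀ v → v ∈ V → 1 ≤ f v
    d+f≥3 : ∀ v → v ∈ V → 3 ≤ d v + f v
    sum-d : sumOn V d + 2 ≡ length V + length V
    sum-f : sumOn V f + 2 ≡ length V + length V

open TreeSeqPair

TreeSeqPair-swap : ∀ {n} {V : List (Fin n)} {d f} → TreeSeqPair V d f → TreeSeqPair V f d
TreeSeqPair-swap {d = d} {f} W = record
  { unique = unique W ; d≥1 = f≥1 W ; f≥1 = d≥1 W
  ; d+f≥3 = λ v m → subst (3 ≤_) (+-comm (d v) (f v)) (d+f≥3 W v m)
  ; sum-d = sum-f W ; sum-f = sum-d W }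

record CaterpillarPair {n} (V : List (Fin n)) (d f : Fin n → ℕ) : Set where
  field
    spine₁ : List (Fin n)
    attach₁ : Fin n → Fin n
    spine₂ : List (Fin n)
    attach₂ : Fin n → Fin n
    cat₁ : Caterpillar V d spine₁ attach₁
    cat₂ : Caterpillar V f spine₂ attach₂
    disjoint : EdgeDisjointOn V spine₁ attach₁ spine₂ attach₂
open CaterpillarPair

CaterpillarPair-swap : ∀ {n} {V : List (Fin n)} {d f} → CaterpillarPair V f d → CaterpillarPair V d f
CaterpillarPair-swap P = record
  { spine₁ = spine₂ P ; attach₁ = attach₂ P ; spine₂ = spine₁ P ; attach₂ = attach₁ P
  ; cat₁ = cat₂ P ; cat₂ = cat₁ P
  ; disjoint = EdgeDisjointOn-swap {s₁ = spine₁ P} {attach₁ P} {spine₂ P} {attach₂ P} (disjoint P) }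

decAt : ∀ {n} → (Fin n → ℕ) → Fin n → Fin n → ℕ
decAt d y v = if eqb y v then pred (d v) else d v

decAt-same : ∀ {n} (d : Fin n → ℕ) y → decAt d y y ≡ pred (d y)
decAt-same d y rewrite eqb-refl y = refl

decAt-other : ∀ {n} (d : Fin n → ℕ) y {v} → y ≢ v → decAt d y v ≡ d v
decAt-other d y {v} ne rewrite ≢⇒eqb-false y v ne = refl

decAt-≤ : ∀ {n} (d : Fin n → ℕ) y v → decAt d y v ≤ d v
decAt-≤ d y v with eqb y v
... | true = pred[n]≤n
... | false = ≤-refl

treeSum-pred : ∀ X L → suc (suc X) + 2 ≡ suc L + suc L → X + 2 ≡ L + L
treeSum-pred X L e = suc-injective (suc-injective (trans e (cong suc (+-suc L L))))

star-sum-impossible : ∀ a b c L → 1 ≤ a → 2 ≤ b → L * 2 ≤ c → a + (b + c) + 2 ≡ suc (suc L) + suc (suc L) → ⊥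
star-sum-impossible a b c L ha hb hc e = <-irrefl refl (begin-strict
  L * 2 + 4                  <⟨ ≤-reflexive (normalise₁ L) ⟩
  1 + (2 + L * 2) + 2        ≤⟨ +-monoˡ-≤ 2 (+-mono-≤ ha (+-mono-≤ hb hc)) ⟩
  a + (b + c) + 2            ≡⟨ e ⟩
  suc (suc L) + suc (suc L)  ≡⟨ normalise₂ L ⟩
  L * 2 + 4                  ∎)
  where
  open ≤-Reasoning
  normalise₁ : ∀ L → suc (L * 2 + 4) ≡ 1 + (2 + L * 2) + 2
  normalise₁ = solve-∀
  normalise₂ : ∀ L → suc (suc L) + suc (suc L) ≡ L * 2 + 4
  normalise₂ = solve-∀

triple+1 : ∀ m → m + m + (m + m) ≡ m * 3 + m
triple+1 = solve-∀

sum-d+f⇒length≥4 : ∀ a m → a + 4 ≡ m + m + (m + m) → m * 3 ≤ a → 4 ≤ m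
sum-d+f⇒length≥4 a m e le = +-cancelˡ-≤ (m * 3) 4 m (≤-trans (+-monoˡ-≤ 4 le) (≤-reflexive (trans e (triple+1 m))))

sum-d+f : ∀ {n} {V : List (Fin n)} {d f} → TreeSeqPair V d f → sumOn V (λ u → d u + f u) + 4 ≡ length V + length V + (length V + length V)
sum-d+f {V = V} {d} {f} W = trans (cong (_+ 4) (sumOn-+ V d f)) (trans (id4 (sumOn V d) (sumOn V f)) (cong₂ _+_ (sum-d W) (sum-f W)))
  where
  id4 : ∀ p q → p + q + 4 ≡ p + 2 + (q + 2)
  id4 = solve-∀

length≥4 : ∀ {n} {V : List (Fin n)} {d f} → TreeSeqPair V d f → 4 ≤ length V
length≥4 {V = V} W = sum-d+f⇒length≥4 _ (length V) (sum-d+f W) (sumOn-≥ V 3 (d+f≥3 W))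

removeLeaf : ∀ {n} {V : List (Fin n)} {d f} (x y : Fin n) → TreeSeqPair V d f → x ∈ V → y ∈ remove x V →
         d x ≡ 1 → f x ≡ 2 → 2 ≤ d y → 4 ≤ d y + f y → TreeSeqPair (remove x V) (decAt d y) f
removeLeaf {n} {V} {d} {f} x y W mx my dx fx dy dfy = record
  { unique = uV′
  ; d≥1 = d′≥1
  ; f≥1 = λ v m → f≥1 W v (proj₁ (∈-remove⁻ V m))
  ; d+f≥3 = d′+f≥3
  ; sum-d = treeSum-pred _ _ (trans (cong (_+ 2) (sym Σd)) (trans (sum-d W) (cong₂ _+_ lenV lenV)))
  ; sum-f = treeSum-pred _ _ (trans (cong (_+ 2) (sym Σf)) (trans (sum-f W) (cong₂ _+_ lenV lenV)))
  }
  where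
  V′ : List (Fin n)
  V′ = remove x V
  uV′ : Unique V′
  uV′ = remove-unique x (unique W)
  suc-pred-dy : suc (pred (d y)) ≡ d y
  suc-pred-dy = suc-pred (d y) {{>-nonZero (≤-trans (s≤s z≤n) dy)}}
  d′≥1 : ∀ v → v ∈ V′ → 1 ≤ decAt d y v
  d′≥1 v m with y ≟ᶠ v
  ... | yes refl = pred-mono-≤ dy
  ... | no ne = d≥1 W v (proj₁ (∈-remove⁻ V m))
  d′+f≥3 : ∀ v → v ∈ V′ → 3 ≤ decAt d y v + f v
  d′+f≥3 v m with y ≟ᶠ v
  ... | yes refl = ≤-pred (subst (4 ≤_) (cong (_+ f v) (sym suc-pred-dy)) dfy)
  ... | no ne = d+f≥3 W v (proj₁ (∈-remove⁻ V m))
  lenV : length V ≡ suc (length V′)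
  lenV = length-remove (unique W) mx
  Σd : sumOn V d ≡ suc (suc (sumOn V′ (decAt d y)))
  Σd = begin
    sumOn V d                                                  ≡⟨ sumOn-remove d (unique W) mx ⟩
    d x + sumOn V′ d                                           ≡⟨ cong (_+ sumOn V′ d) dx ⟩
    suc (sumOn V′ d)                                           ≡⟨ cong suc (sumOn-remove d uV′ my) ⟩
    suc (d y + sumOn (remove y V′) d)                          ≡⟨ cong (λ k → suc (k + sumOn (remove y V′) d)) suc-pred-dy ⟨
    suc (suc (pred (d y) + sumOn (remove y V′) d))             ≡⟨ cong (λ k → suc (suc k)) (cong₂ _+_ (decAt-same d y) unchanged) ⟨
    suc (suc (decAt d y y + sumOn (remove y V′) (decAt d y)))  ≡⟨ cong (λ k → suc (suc k)) (sumOn-remove (decAt d y) uV′ my) ⟨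
    suc (suc (sumOn V′ (decAt d y)))                           ∎
    where
    open ≡-Reasoning
    unchanged : sumOn (remove y V′) (decAt d y) ≡ sumOn (remove y V′) d
    unchanged = sumOn-cong (remove y V′) (λ v m → decAt-other d y (λ q → proj₂ (∈-remove⁻ V′ m) (sym q)))
  Σf : sumOn V f ≡ suc (suc (sumOn V′ f))
  Σf = trans (sumOn-remove f (unique W) mx) (cong (_+ sumOn V′ f) fx)

not-star : ∀ {n} {V : List (Fin n)} {d f} (x y : Fin n) → TreeSeqPair V d f → x ∈ V → y ∈ remove x V → 2 ≤ d y →
          (∀ v → v ∈ remove x V → v ≢ y → f v ≤ 1) → ⊥
not-star {n} {V} {d} {f} x y W mx my dy F =
  star-sum-impossible (d x) (d y) (sumOn V'' d) (length V'') (d≥1 W x mx) dy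
    (sumOn-≥ V'' 2 low)
    (trans (cong (_+ 2) (sym S)) (trans (sum-d W) (cong₂ _+_ len len)))
  where
  V' V'' : List (Fin n)
  V' = remove x V
  V'' = remove y V'
  uV' : Unique V'
  uV' = remove-unique x (unique W)
  S : sumOn V d ≡ d x + (d y + sumOn V'' d)
  S = trans (sumOn-remove d (unique W) mx) (cong (d x +_) (sumOn-remove d uV' my))
  len : length V ≡ suc (suc (length V''))
  len = trans (length-remove (unique W) mx) (cong suc (length-remove uV' my))
  low : ∀ v → v ∈ V'' → 2 ≤ d v
  low v m = let (m1 , ny) = ∈-remove⁻ V' m in let (m2 , nx) = ∈-remove⁻ V m1 in
    ≤-pred (≤-trans (subst (3 ≤_) (+-comm (d v) (f v)) (d+f≥3 W v m2)) (+-monoˡ-≤ (d v) (F v m1 ny)))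

sum≡3-cases : ∀ a b → a + b ≡ 3 → 1 ≤ a → 1 ≤ b → (a ≡ 1 × b ≡ 2) ⊎ (a ≡ 2 × b ≡ 1)
sum≡3-cases zero b e () _
sum≡3-cases (suc zero) b e _ _ = inj₁ (refl , suc-injective e)
sum≡3-cases (suc (suc zero)) b e _ _ = inj₂ (refl , suc-injective (suc-injective e))
sum≡3-cases (suc (suc (suc a))) zero e _ ()
sum≡3-cases (suc (suc (suc a))) (suc b) e _ _ with trans (sym (+-suc a b)) (suc-injective (suc-injective (suc-injective e)))
... | ()

≱3⇒≤2 : ∀ {m} → ¬ (3 ≤ m) → m ≤ 2
≱3⇒≤2 nle = ≤-pred (≰⇒> nle)

≱2⇒≤1 : ∀ {m} → ¬ (2 ≤ m) → m ≤ 1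
≱2⇒≤1 nle = ≤-pred (≰⇒> nle)

≤2-≢2⇒≡1 : ∀ {m} → 1 ≤ m → m ≤ 2 → m ≢ 2 → m ≡ 1
≤2-≢2⇒≡1 {suc zero} _ _ _ = refl
≤2-≢2⇒≡1 {suc (suc zero)} _ _ ne = ⊥-elim (ne refl)
≤2-≢2⇒≡1 {suc (suc (suc m))} _ (s≤s (s≤s ())) _

attachAtLeaf : ∀ {n} {V' : List (Fin n)} {g' g : Fin n → ℕ} {s a} (x y : Fin n) →
               Caterpillar V' g' s a → Unique V' → x ∉ V' → y ∈ V' → memb y s ≡ false → g' (a y) ≤ 2 →
               1 ≤ g' y → g x ≡ 1 → g y ≡ suc (g' y) → (∀ v → v ∈ V' → v ≢ y → g v ≡ g' v) → ExtensionAt V' x y g s a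
attachAtLeaf {V' = V'} {g'} {s = s} {a} x y C uV nx my ny a≤2 g1 gx gy go
  with lowDegreeSpineVertex-isEnd C uV (memb⇒∈ (a y) s (leaf-attached C y my ny)) my ny refl a≤2
... | inj₁ (t , e) = ExtensionAt-cong (λ u v → cong (λ z → catAdj z a u v) (sym e))
        (attachAtSpineEnd x y (subst (λ z → Caterpillar V' g' z a) e C) uV nx my (trans (cong (memb y) (sym e)) ny) refl g1 gx gy go)
... | inj₂ (r , e) = ExtensionAt-cong (λ u v → trans (cong (λ z → catAdj z a u v) (sym e)) (catAdj-reverse s a u v))
        (attachAtSpineEnd x y (subst (λ z → Caterpillar V' g' z a) e (Caterpillar-reverse C)) uV nx my
           (trans (cong (memb y) (sym e)) (trans (memb-reverse y s) ny)) refl g1 gx gy go)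

module Step {n : ℕ} (k : ℕ)
            (IH : ∀ (V′ : List (Fin n)) d f → length V′ ≡ k → TreeSeqPair V′ d f → CaterpillarPair V′ d f) where

  removeLeaf-extend : ∀ (V : List (Fin n)) d f → length V ≡ suc k → TreeSeqPair V d f →
                      (x y : Fin n) → x ∈ V → y ∈ remove x V → d x ≡ 1 → f x ≡ 2 → 2 ≤ d y → 4 ≤ d y + f y →
                      (∀ {s a} → Caterpillar (remove x V) (decAt d y) s a → ExtensionAt (remove x V) x y d s a) →
                      CaterpillarPair V d f
  removeLeaf-extend V d f len W x y mx my dx fx dy dfy extend₁ = record
    { spine₁ = ExtensionAt.spine E₁ ; attach₁ = ExtensionAt.attach E₁
    ; spine₂ = ExtensionAvoiding.spine E₂ ; attach₂ = ExtensionAvoiding.attach E₂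
    ; cat₁ = Caterpillar-unremove (unique W) mx (ExtensionAt.cat E₁)
    ; cat₂ = Caterpillar-unremove (unique W) mx (ExtensionAvoiding.cat E₂)
    ; disjoint = EdgeDisjointOn-⊆ {s₁ = ExtensionAt.spine E₁} {ExtensionAt.attach E₁}
                   {ExtensionAvoiding.spine E₂} {ExtensionAvoiding.attach E₂}
                   (EdgeDisjointOn-extend (disjoint R) E₁ E₂) (∈-unremove mx) }
    where
    R : CaterpillarPair (remove x V) (decAt d y) f
    R = IH (remove x V) (decAt d y) f (suc-injective (trans (sym (length-remove (unique W) mx)) len))
           (removeLeaf x y W mx my dx fx dy dfy)
    E₁ : ExtensionAt (remove x V) x y d (spine₁ R) (attach₁ R)
    E₁ = extend₁ (cat₁ R)
    E₂ : ExtensionAvoiding (remove x V) x y f (spine₂ R) (attach₂ R)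
    E₂ = insertAvoiding x y (cat₂ R) (remove-unique x (unique W)) (∉-remove x V) my (not-star x y W mx my dy) fx

  stepHighDegree : ∀ (V : List (Fin n)) d f → length V ≡ suc k → TreeSeqPair V d f →
                   (x y : Fin n) → x ∈ V → y ∈ V → d x ≡ 1 → f x ≡ 2 → 3 ≤ d y → CaterpillarPair V d f
  stepHighDegree V d f len W x y mx my dx fx dy =
    removeLeaf-extend V d f len W x y mx my′ dx fx (≤-trans (n≤1+n 2) dy) (+-mono-≤ dy (f≥1 W y my)) extend₁
    where
    y≢x : y ≢ x
    y≢x refl with subst (3 ≤_) dx dy
    ... | s≤s ()
    my′ : y ∈ remove x V
    my′ = ∈-remove⁺ V my y≢x
    extend₁ : ∀ {s a} → Caterpillar (remove x V) (decAt d y) s a → ExtensionAt (remove x V) x y d s a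
    extend₁ C = attachAtSpine x y C (remove-unique x (unique W)) (∉-remove x V) my′
      (deg≥2⇒spine C y my′ (subst (2 ≤_) (sym (decAt-same d y)) (pred-mono-≤ dy)))
      dx (sym (trans (cong suc (decAt-same d y)) (suc-pred (d y) {{>-nonZero (≤-trans (s≤s z≤n) dy)}})))
      (λ v m ne → sym (decAt-other d y (λ q → ne (sym q))))

  stepDegreeTwo : ∀ (V : List (Fin n)) d f → length V ≡ suc k → TreeSeqPair V d f →
                  (x y : Fin n) → x ∈ V → y ∈ V → d x ≡ 1 → f x ≡ 2 → d y ≡ 2 → 2 ≤ f y →
                  (∀ v → v ∈ V → d v ≤ 2) → CaterpillarPair V d f
  stepDegreeTwo V d f len W x y mx my dx fx dy fy d≤2 =
    removeLeaf-extend V d f len W x y mx my′ dx fx (≤-reflexive (sym dy)) (+-mono-≤ (≤-reflexive (sym dy)) fy) extend₁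
    where
    y≢x : y ≢ x
    y≢x refl with trans (sym dx) dy
    ... | ()
    my′ : y ∈ remove x V
    my′ = ∈-remove⁺ V my y≢x
    d′ : Fin n → ℕ
    d′ = decAt d y
    d′y≡1 : d′ y ≡ 1
    d′y≡1 = trans (decAt-same d y) (cong pred dy)
    extend₁ : ∀ {s a} → Caterpillar (remove x V) d′ s a → ExtensionAt (remove x V) x y d s a
    extend₁ {s} {a} C = attachAtLeaf x y C (remove-unique x (unique W)) (∉-remove x V) my′ y-leaf
      (≤-trans (decAt-≤ d y (a y)) (d≤2 (a y) (proj₁ (∈-remove⁻ V (spine⊆ C (a y) (memb⇒∈ (a y) s (leaf-attached C y my′ y-leaf)))))))
      (≤-reflexive (sym d′y≡1)) dx (trans dy (cong suc (sym d′y≡1))) (λ v m ne → sym (decAt-other d y (λ q → ne (sym q))))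
      where
      y-leaf : memb y s ≡ false
      y-leaf with memb y s in e
      ... | true with subst (2 ≤_) d′y≡1 (spine⇒deg≥2 C y my′ e)
      ...   | s≤s ()
      y-leaf | false = refl

  all-d≡1-impossible : ∀ (V : List (Fin n)) d f → length V ≡ suc k → 5 ≤ suc k → TreeSeqPair V d f →
                       (∀ v → v ∈ V → d v ≡ 1) → ⊥
  all-d≡1-impossible V d f len 5≤ W d≡1 =
    <⇒≢ (≤-trans (s≤s (s≤s (s≤s z≤n))) (subst (5 ≤_) (sym len) 5≤))
        (+-cancelˡ-≡ (length V) 2 (length V) (trans (cong (_+ 2) (sym Σd)) (sum-d W)))
    where
    Σd : sumOn V d ≡ length V
    Σd = trans (sumOn-cong V d≡1) (sumOn-one V)

  all-d+f≡3-impossible : ∀ (V : List (Fin n)) d f → length V ≡ suc k → 5 ≤ suc k → TreeSeqPair V d f →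
                         (∀ v → v ∈ V → d v + f v ≡ 3) → ⊥
  all-d+f≡3-impossible V d f len 5≤ W d+f≡3 =
    <⇒≢ (subst (4 <_) (sym len) 5≤)
        (+-cancelˡ-≡ (length V * 3) 4 (length V)
          (trans (cong (_+ 4) (sym Σd+f)) (trans (sum-d+f W) (triple+1 (length V)))))
    where
    Σd+f : sumOn V (λ v → d v + f v) ≡ length V * 3
    Σd+f = trans (sumOn-cong V d+f≡3) (sumOn-const V 3)

  step : ∀ (V : List (Fin n)) d f → length V ≡ suc k → 5 ≤ suc k → TreeSeqPair V d f →
         (x : Fin n) → x ∈ V → d x ≡ 1 → f x ≡ 2 → CaterpillarPair V d f
  step V d f len 5≤ W x mx dx fx with search (λ v → 3 ≤? d v) V
  ... | inj₁ (y , my , dy) = stepHighDegree V d f len W x y mx my dx fx dy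
  ... | inj₂ ¬d≥3 with search (λ v → (d v ≟ 2) ×-dec (2 ≤? f v)) V
  ... | inj₁ (y , my , (dy , fy)) = stepDegreeTwo V d f len W x y mx my dx fx dy fy (λ v m → ≱3⇒≤2 (¬d≥3 v m))
  ... | inj₂ ¬d≡2∧f≥2 with search (λ v → d v ≟ 2) V
  ... | inj₂ ¬d≡2 = ⊥-elim (all-d≡1-impossible V d f len 5≤ W
                      (λ v m → ≤2-≢2⇒≡1 (d≥1 W v m) (≱3⇒≤2 (¬d≥3 v m)) (¬d≡2 v m)))
  ... | inj₁ (z , mz , dz) with search (λ v → 3 ≤? f v) V
  ... | inj₁ (w , mw , fw) = CaterpillarPair-swap (stepHighDegree V f d len (TreeSeqPair-swap W) z w mz mw fz dz fw)
    where
    fz : f z ≡ 1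
    fz = ≤-antisym (≱2⇒≤1 (λ le → ¬d≡2∧f≥2 z mz (dz , le))) (f≥1 W z mz)
  ... | inj₂ ¬f≥3 = ⊥-elim (all-d+f≡3-impossible V d f len 5≤ W d+f≡3)
    where
    d+f≡3 : ∀ v → v ∈ V → d v + f v ≡ 3
    d+f≡3 v m with d v ≟ 2
    ... | yes e = trans (cong (_+ f v) e) (cong (2 +_) (≤-antisym (≱2⇒≤1 (λ le → ¬d≡2∧f≥2 v m (e , le))) (f≥1 W v m)))
    ... | no ne = trans (cong (_+ f v) e1) (cong suc (≤-antisym (≱3⇒≤2 (¬f≥3 v m)) (≤-pred (subst (λ z → 3 ≤ z + f v) e1 (d+f≥3 W v m)))))
      where
      e1 : d v ≡ 1
      e1 = ≤2-≢2⇒≡1 (d≥1 W v m) (≱3⇒≤2 (¬d≥3 v m)) ne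

catAdj-star : ∀ {n} (c u v : Fin n) → catAdj (c ∷ []) (λ _ → c) u v ≡ true → u ≡ c ⊎ v ≡ c
catAdj-star c u v e with ∨-true⁻ (not (eqb c u ∨ false) ∧ eqb c v) _ e
... | inj₁ e1 = inj₂ (sym (eqb⇒≡ c v (∧-trueʳ _ _ e1)))
... | inj₂ e2 = inj₁ (sym (eqb⇒≡ c u (∧-trueʳ _ _ e2)))

Unique₃ : ∀ {n} {a b c : Fin n} → a ≢ b → a ≢ c → b ≢ c → Unique (a ∷ b ∷ c ∷ [])
Unique₃ ab ac bc = (ab ∷ ac ∷ []) ∷ (bc ∷ []) ∷ [] ∷ []

Unique₄ : ∀ {n} {a b c d : Fin n} → a ≢ b → a ≢ c → a ≢ d → b ≢ c → b ≢ d → c ≢ d → Unique (a ∷ b ∷ c ∷ d ∷ [])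
Unique₄ ab ac ad bc bd cd = (ab ∷ ac ∷ ad ∷ []) ∷ (bc ∷ bd ∷ []) ∷ (cd ∷ []) ∷ [] ∷ []

-- T₁ is the path c a b e and T₂ the path b c e a.
module FourVertices {n : ℕ} (V : List (Fin n)) (d f : Fin n → ℕ) (W : TreeSeqPair V d f)
            (a b c e : Fin n) (ma : a ∈ V) (mb : b ∈ V) (mc : c ∈ V) (me : e ∈ V)
            (ab : a ≢ b) (ac : a ≢ c) (ae : a ≢ e) (bc : b ≢ c) (be : b ≢ e) (ce : c ≢ e)
            (cls : ∀ v → v ∈ V → v ≡ a ⊎ v ≡ b ⊎ v ≡ c ⊎ v ≡ e)
            (da : d a ≡ 2) (db : d b ≡ 2) (dc : d c ≡ 1) (de : d e ≡ 1)
            (fa : f a ≡ 1) (fb : f b ≡ 1) (fc : f c ≡ 2) (fe : f e ≡ 2) where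

  V₁ : List (Fin n)
  V₁ = a ∷ b ∷ c ∷ []
  uV₁ : Unique V₁
  uV₁ = Unique₃ ab ac bc
  d′ : Fin n → ℕ
  d′ = decAt d b
  star₁ : Caterpillar V₁ d′ (a ∷ []) (λ _ → a)
  star₁ = star a uV₁ (here refl) (cong suc d′a≡2) (≤-reflexive (sym d′a≡2)) others
    where
    d′a≡2 : d′ a ≡ 2
    d′a≡2 = trans (decAt-other d b (≢-sym ab)) da
    others : ∀ v → v ∈ V₁ → v ≢ a → d′ v ≡ 1
    others v (here refl) ne = ⊥-elim (ne refl)
    others v (there (here refl)) ne = trans (decAt-same d b) (cong pred db)
    others v (there (there (here refl))) ne = trans (decAt-other d b bc) dc
  E₁ : ExtensionAt V₁ e b d (a ∷ []) (λ _ → a)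
  E₁ = attachAtSpineEnd e b star₁ uV₁ e∉V₁ (there (here refl)) (cong (_∨ false) (≢⇒eqb-false a b ab)) refl
         (≤-reflexive (sym (trans (decAt-same d b) (cong pred db)))) de
         (trans db (cong suc (sym (trans (decAt-same d b) (cong pred db))))) others
    where
    e∉V₁ : e ∉ V₁
    e∉V₁ (here q) = ae (sym q)
    e∉V₁ (there (here q)) = be (sym q)
    e∉V₁ (there (there (here q))) = ce (sym q)
    others : ∀ v → v ∈ V₁ → v ≢ b → d v ≡ d′ v
    others v m ne = sym (decAt-other d b (≢-sym ne))

  V₂ : List (Fin n)
  V₂ = c ∷ e ∷ b ∷ []
  uV₂ : Unique V₂
  uV₂ = Unique₃ ce (≢-sym bc) (≢-sym be)
  f′ : Fin n → ℕ
  f′ = decAt f e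
  star₂ : Caterpillar V₂ f′ (c ∷ []) (λ _ → c)
  star₂ = star c uV₂ (here refl) (cong suc f′c≡2) (≤-reflexive (sym f′c≡2)) others
    where
    f′c≡2 : f′ c ≡ 2
    f′c≡2 = trans (decAt-other f e (≢-sym ce)) fc
    others : ∀ v → v ∈ V₂ → v ≢ c → f′ v ≡ 1
    others v (here refl) ne = ⊥-elim (ne refl)
    others v (there (here refl)) ne = trans (decAt-same f e) (cong pred fe)
    others v (there (there (here refl))) ne = trans (decAt-other f e (≢-sym be)) fb
  E₂ : ExtensionAt V₂ a e f (c ∷ []) (λ _ → c)
  E₂ = attachAtSpineEnd a e star₂ uV₂ a∉V₂ (there (here refl)) (cong (_∨ false) (≢⇒eqb-false c e ce)) refl
         (≤-reflexive (sym (trans (decAt-same f e) (cong pred fe)))) fa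
         (trans fe (cong suc (sym (trans (decAt-same f e) (cong pred fe))))) others
    where
    a∉V₂ : a ∉ V₂
    a∉V₂ (here q) = ac q
    a∉V₂ (there (here q)) = ae q
    a∉V₂ (there (there (here q))) = ab q
    others : ∀ v → v ∈ V₂ → v ≢ e → f v ≡ f′ v
    others v m ne = sym (decAt-other f e (≢-sym ne))

  W₁ : List (Fin n)
  W₁ = e ∷ V₁
  W₂ : List (Fin n)
  W₂ = a ∷ V₂
  ∈W₁ : ∀ v → v ∈ V → v ∈ W₁
  ∈W₁ v m with cls v m
  ... | inj₁ refl = there (here refl)
  ... | inj₂ (inj₁ refl) = there (there (here refl))
  ... | inj₂ (inj₂ (inj₁ refl)) = there (there (there (here refl)))
  ... | inj₂ (inj₂ (inj₂ refl)) = here refl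
  ∈W₂ : ∀ v → v ∈ V → v ∈ W₂
  ∈W₂ v m with cls v m
  ... | inj₁ refl = here refl
  ... | inj₂ (inj₁ refl) = there (there (there (here refl)))
  ... | inj₂ (inj₂ (inj₁ refl)) = there (here refl)
  ... | inj₂ (inj₂ (inj₂ refl)) = there (there (here refl))
  W₁⊆ : ∀ v → v ∈ W₁ → v ∈ V
  W₁⊆ v (here refl) = me
  W₁⊆ v (there (here refl)) = ma
  W₁⊆ v (there (there (here refl))) = mb
  W₁⊆ v (there (there (there (here refl)))) = mc
  W₂⊆ : ∀ v → v ∈ W₂ → v ∈ V
  W₂⊆ v (here refl) = ma
  W₂⊆ v (there (here refl)) = mc
  W₂⊆ v (there (there (here refl))) = me
  W₂⊆ v (there (there (there (here refl)))) = mb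
  uW₁ : Unique W₁
  uW₁ = Unique₄ (≢-sym ae) (≢-sym be) (≢-sym ce) ab ac bc
  uW₂ : Unique W₂
  uW₂ = Unique₄ ac ae ab ce (≢-sym bc) (≢-sym be)

  s₁ : List (Fin n)
  s₁ = ExtensionAt.spine E₁
  a₁ : Fin n → Fin n
  a₁ = ExtensionAt.attach E₁
  s₂ : List (Fin n)
  s₂ = ExtensionAt.spine E₂
  a₂ : Fin n → Fin n
  a₂ = ExtensionAt.attach E₂
  C₁ : Caterpillar V d s₁ a₁
  C₁ = Caterpillar-transport (ExtensionAt.cat E₁) ∈W₁ W₁⊆
         (λ k → sumOn-⊆⊇ (λ u → bool→ℕ (k u)) (unique W) uW₁ ∈W₁ W₁⊆) (λ _ _ → refl)
  C₂ : Caterpillar V f s₂ a₂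
  C₂ = Caterpillar-transport (ExtensionAt.cat E₂) ∈W₂ W₂⊆
         (λ k → sumOn-⊆⊇ (λ u → bool→ℕ (k u)) (unique W) uW₂ ∈W₂ W₂⊆) (λ _ _ → refl)

  A₁ : Fin n → Fin n → Bool
  A₁ = catAdj s₁ a₁
  A₂ : Fin n → Fin n → Bool
  A₂ = catAdj s₂ a₂
  disjoint-at-e : ∀ v → v ∈ V → A₁ e v ≡ true → A₂ e v ≡ true → ⊥
  disjoint-at-e v m e1 e2 with ExtensionAt.fresh E₁ v (∈W₁ v m) e1
  ... | refl with catAdj-star c e v (ExtensionAt.old E₂ e v (there (here refl)) (there (there (here refl))) e2)
  ... | inj₁ q = ce (sym q)
  ... | inj₂ q = bc q
  disjoint-at-a : ∀ v → v ∈ V → A₁ a v ≡ true → A₂ a v ≡ true → ⊥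
  disjoint-at-a v m e1 e2 with ExtensionAt.fresh E₂ v (∈W₂ v m) e2
  ... | refl = disjoint-at-e a ma (trans (catAdj-sym s₁ a₁ e a) e1) (trans (catAdj-sym s₂ a₂ e a) e2)
  caterpillarPair : CaterpillarPair V d f
  caterpillarPair = record
    { spine₁ = s₁ ; attach₁ = a₁ ; spine₂ = s₂ ; attach₂ = a₂ ; cat₁ = C₁ ; cat₂ = C₂ ; disjoint = D }
    where
    ∈V₁ : ∀ v → v ∈ V → v ≢ a → v ≢ e → v ∈ V₁
    ∈V₁ v m na ne with cls v m
    ... | inj₁ q = ⊥-elim (na q)
    ... | inj₂ (inj₁ refl) = there (here refl)
    ... | inj₂ (inj₂ (inj₁ refl)) = there (there (here refl))
    ... | inj₂ (inj₂ (inj₂ q)) = ⊥-elim (ne q)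
    D : EdgeDisjointOn V s₁ a₁ s₂ a₂
    D u v mu mv e1 e2 with u ≟ᶠ a | u ≟ᶠ e | v ≟ᶠ a | v ≟ᶠ e
    ... | yes refl | _ | _ | _ = disjoint-at-a v mv e1 e2
    ... | no _ | yes refl | _ | _ = disjoint-at-e v mv e1 e2
    ... | no _ | no _ | yes refl | _ = disjoint-at-a u mu (trans (catAdj-sym s₁ a₁ v u) e1) (trans (catAdj-sym s₂ a₂ v u) e2)
    ... | no _ | no _ | no _ | yes refl = disjoint-at-e u mu (trans (catAdj-sym s₁ a₁ v u) e1) (trans (catAdj-sym s₂ a₂ v u) e2)
    ... | no ua | no ue | no va | no ve with catAdj-star a u v (ExtensionAt.old E₁ u v (∈V₁ u mu ua ue) (∈V₁ v mv va ve) e1)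
    ... | inj₁ q = ua q
    ... | inj₂ q = va q

module FourVertexCase {n : ℕ} (V : List (Fin n)) (d f : Fin n → ℕ) (len : length V ≡ 4) (W : TreeSeqPair V d f) where
  uV : Unique V
  uV = unique W
  Σd+f≡12 : sumOn V (λ u → d u + f u) ≡ 12
  Σd+f≡12 = +-cancelˡ-≡ 4 _ 12 (trans (+-comm 4 _) (trans (sum-d+f W) (cong (λ L → L + L + (L + L)) len)))
  d+f≤3 : ∀ v → v ∈ V → d v + f v ≤ 3
  d+f≤3 v m = +-cancelʳ-≤ 9 _ 3 (≤-trans (+-monoʳ-≤ (d v + f v) low) (≤-reflexive (trans (sym (sumOn-remove (λ u → d u + f u) uV m)) Σd+f≡12)))
    where
    low : 9 ≤ sumOn (remove v V) (λ u → d u + f u)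
    low = subst (λ L → L * 3 ≤ sumOn (remove v V) (λ u → d u + f u)) (suc-injective (trans (sym (length-remove uV m)) len))
            (sumOn-≥ (remove v V) 3 (λ u m' → d+f≥3 W u (proj₁ (∈-remove⁻ V m'))))
  degree-cases : ∀ v → v ∈ V → (d v ≡ 1 × f v ≡ 2) ⊎ (d v ≡ 2 × f v ≡ 1)
  degree-cases v m = sum≡3-cases (d v) (f v) (≤-antisym (d+f≤3 v m) (d+f≥3 W v m)) (d≥1 W v m) (f≥1 W v m)
  Σd≡6 : sumOn V d ≡ 6
  Σd≡6 = suc-injective (suc-injective (trans (+-comm 2 _) (trans (sum-d W) (cong (λ L → L + L) len))))
  sum-d-no2 : ∀ (L : List (Fin n)) → (∀ v → v ∈ L → v ∈ V) → (∀ v → v ∈ L → ¬ (d v ≡ 2)) → sumOn L d ≡ length L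
  sum-d-no2 L LV nop = trans (sumOn-cong L one) (sumOn-one L)
    where
    one : ∀ v → v ∈ L → d v ≡ 1
    one v m with degree-cases v (LV v m)
    ... | inj₁ (x , _) = x
    ... | inj₂ (x , _) = ⊥-elim (nop v m x)
  d≡2⇒f≡1 : ∀ v → v ∈ V → d v ≡ 2 → f v ≡ 1
  d≡2⇒f≡1 v m dv with degree-cases v m
  ... | inj₁ (x , _) with trans (sym x) dv
  ... | ()
  d≡2⇒f≡1 v m dv | inj₂ (_ , y) = y
  d≡1⇒f≡2 : ∀ v → v ∈ V → d v ≡ 1 → f v ≡ 2
  d≡1⇒f≡2 v m dv with degree-cases v m
  ... | inj₂ (x , _) with trans (sym x) dv
  ... | ()
  d≡1⇒f≡2 v m dv | inj₁ (_ , y) = y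

  withTwoOfDegreeTwo : (a b : Fin n) → (ma : a ∈ V) → (mb′ : b ∈ remove a V) → d a ≡ 2 → d b ≡ 2 →
        (V2 : List (Fin n)) → remove b (remove a V) ≡ V2 → length V2 ≡ 2 → sumOn V2 d ≡ 2 → CaterpillarPair V d f
  withTwoOfDegreeTwo a b ma mb′ da db (c ∷ e ∷ []) eq _ Σce =
    FourVertices.caterpillarPair V d f W a b c e ma mb mc me ab ac ae bc be ce cls da db dc de (d≡2⇒f≡1 a ma da) (d≡2⇒f≡1 b mb db) (d≡1⇒f≡2 c mc dc) (d≡1⇒f≡2 e me de)
    where
    V1 : List (Fin n)
    V1 = remove a V
    mb : b ∈ V
    mb = proj₁ (∈-remove⁻ V mb′)
    ab : a ≢ b
    ab q = proj₂ (∈-remove⁻ V mb′) (sym q)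
    mc2 : c ∈ remove b V1
    mc2 = subst (c ∈_) (sym eq) (here refl)
    me2 : e ∈ remove b V1
    me2 = subst (e ∈_) (sym eq) (there (here refl))
    mc1 : c ∈ V1
    mc1 = proj₁ (∈-remove⁻ V1 mc2)
    me1 : e ∈ V1
    me1 = proj₁ (∈-remove⁻ V1 me2)
    mc : c ∈ V
    mc = proj₁ (∈-remove⁻ V mc1)
    me : e ∈ V
    me = proj₁ (∈-remove⁻ V me1)
    ac : a ≢ c
    ac q = proj₂ (∈-remove⁻ V mc1) (sym q)
    ae : a ≢ e
    ae q = proj₂ (∈-remove⁻ V me1) (sym q)
    bc : b ≢ c
    bc q = proj₂ (∈-remove⁻ V1 mc2) (sym q)
    be : b ≢ e
    be q = proj₂ (∈-remove⁻ V1 me2) (sym q)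
    u2 : Unique (c ∷ e ∷ [])
    u2 = subst Unique eq (remove-unique b (remove-unique a uV))
    ce : c ≢ e
    ce with u2
    ... | (p ∷ _) ∷ _ = p
    dc : d c ≡ 1
    dc with degree-cases c mc
    ... | inj₁ (x , _) = x
    ... | inj₂ (x , _) with d≥1 W e me
    ... | le rewrite x = ⊥-elim (<⇒≱ (subst (1 ≤_) (sym (+-identityʳ (d e))) le) (≤-reflexive (suc-injective (suc-injective Σce))))
    de : d e ≡ 1
    de = trans (sym (+-identityʳ (d e))) (suc-injective (trans (cong (_+ (d e + 0)) (sym dc)) Σce))
    cls : ∀ v → v ∈ V → v ≡ a ⊎ v ≡ b ⊎ v ≡ c ⊎ v ≡ e
    cls v m with v ≟ᶠ a
    ... | yes q = inj₁ q
    ... | no na with v ≟ᶠ b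
    ... | yes q = inj₂ (inj₁ q)
    ... | no nb with subst (v ∈_) eq (∈-remove⁺ V1 (∈-remove⁺ V m na) nb)
    ... | here q = inj₂ (inj₂ (inj₁ q))
    ... | there (here q) = inj₂ (inj₂ (inj₂ q))
  withTwoOfDegreeTwo a b ma mb′ da db [] eq () Σce
  withTwoOfDegreeTwo a b ma mb′ da db (_ ∷ []) eq () Σce
  withTwoOfDegreeTwo a b ma mb′ da db (_ ∷ _ ∷ _ ∷ _) eq () Σce

  caterpillarPair : CaterpillarPair V d f
  caterpillarPair with search (λ v → d v ≟ 2) V
  ... | inj₂ noa with trans (sym Σd≡6) (trans (sum-d-no2 V (λ _ m → m) noa) len)
  ... | ()
  caterpillarPair | inj₁ (a , ma , da) with search (λ v → d v ≟ 2) (remove a V)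
  ... | inj₂ nob with trans (sym sum1) (trans (sum-d-no2 (remove a V) (λ v m → proj₁ (∈-remove⁻ V m)) nob) len1)
    where
    len1 : length (remove a V) ≡ 3
    len1 = suc-injective (trans (sym (length-remove uV ma)) len)
    sum1 : sumOn (remove a V) d ≡ 4
    sum1 = suc-injective (suc-injective (trans (cong (_+ sumOn (remove a V) d) (sym da)) (trans (sym (sumOn-remove d uV ma)) Σd≡6)))
  ... | ()
  caterpillarPair | inj₁ (a , ma , da) | inj₁ (b , mb′ , db) =
    withTwoOfDegreeTwo a b ma mb′ da db (remove b (remove a V)) refl len2 sum2
    where
    len1 : length (remove a V) ≡ 3
    len1 = suc-injective (trans (sym (length-remove uV ma)) len)
    len2 : length (remove b (remove a V)) ≡ 2
    len2 = suc-injective (trans (sym (length-remove (remove-unique a uV) mb′)) len1)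
    sum1 : sumOn (remove a V) d ≡ 4
    sum1 = suc-injective (suc-injective (trans (cong (_+ sumOn (remove a V) d) (sym da)) (trans (sym (sumOn-remove d uV ma)) Σd≡6)))
    sum2 : sumOn (remove b (remove a V)) d ≡ 2
    sum2 = suc-injective (suc-injective (trans (cong (_+ sumOn (remove b (remove a V)) d) (sym db))
             (trans (sym (sumOn-remove d (remove-unique a uV) mb′)) sum1)))

quadruple : ∀ L → L + L + (L + L) ≡ L * 4
quadruple = solve-∀

vertex-d+f≡3 : ∀ {n} {V : List (Fin n)} {d f} → TreeSeqPair V d f → Σ (Fin n) λ x → x ∈ V × d x + f x ≡ 3
vertex-d+f≡3 {V = V} {d} {f} W with search (λ v → d v + f v ≤? 3) V
... | inj₁ (x , mx , le) = x , mx , ≤-antisym le (d+f≥3 W x mx)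
... | inj₂ none = ⊥-elim (m+1+n≰m (length V * 4) (begin
  length V * 4 + 4                             ≤⟨ +-monoˡ-≤ 4 (sumOn-≥ V 4 (λ v m → ≰⇒> (none v m))) ⟩
  sumOn V (λ u → d u + f u) + 4                ≡⟨ sum-d+f W ⟩
  length V + length V + (length V + length V)  ≡⟨ quadruple (length V) ⟩
  length V * 4                                 ∎))
  where open ≤-Reasoning

caterpillarPair-byLength : ∀ {n} (k : ℕ) (V : List (Fin n)) d f → length V ≡ k → TreeSeqPair V d f →
                           CaterpillarPair V d f
caterpillarPair-byLength zero V d f len W with subst (4 ≤_) len (length≥4 W)
... | ()
caterpillarPair-byLength {n} (suc k) V d f len W with suc k ≟ 4
... | yes len≡4 = FourVertexCase.caterpillarPair V d f (trans len len≡4) W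
... | no len≢4 = removeLeafStep (≤∧≢⇒< (subst (4 ≤_) len (length≥4 W)) (λ q → len≢4 (sym q))) (vertex-d+f≡3 W)
  where
  removeLeafStep : 5 ≤ suc k → Σ (Fin n) (λ x → x ∈ V × d x + f x ≡ 3) → CaterpillarPair V d f
  removeLeafStep 5≤ (x , mx , d+f≡3) with sum≡3-cases (d x) (f x) d+f≡3 (d≥1 W x mx) (f≥1 W x mx)
  ... | inj₁ (dx , fx) = Step.step k (caterpillarPair-byLength k) V d f len 5≤ W x mx dx fx
  ... | inj₂ (dx , fx) = CaterpillarPair-swap
                           (Step.step k (caterpillarPair-byLength k) V f d len 5≤ (TreeSeqPair-swap W) x mx fx dx)

caterpillarPair : ∀ {n} {V : List (Fin n)} {d f} → TreeSeqPair V d f → CaterpillarPair V d f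
caterpillarPair W = caterpillarPair-byLength _ _ _ _ refl W

TreeSeqPair-allFin : ∀ {n} {d f : Fin n → ℕ} → 2 ≤ n → IsTreeSeq n d → IsTreeSeq n f → (∀ i → 3 ≤ d i + f i) →
                     TreeSeqPair (allFin n) d f
TreeSeqPair-allFin {n} {d} {f} 2≤n (d≥1 , Σd) (f≥1 , Σf) d+f≥3 = record
  { unique = allFin⁺ n ; d≥1 = λ v _ → d≥1 v ; f≥1 = λ v _ → f≥1 v ; d+f≥3 = λ v _ → d+f≥3 v
  ; sum-d = treeSum Σd ; sum-f = treeSum Σf }
  where
  length-allFin : length (allFin n) ≡ n
  length-allFin = length-tabulate id
  treeSum : ∀ {g : Fin n → ℕ} → sumOn (allFin n) g ≡ 2 * n ∸ 2 → sumOn (allFin n) g + 2 ≡ length (allFin n) + length (allFin n)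
  treeSum {g} Σg = begin
    sumOn (allFin n) g + 2                 ≡⟨ cong (_+ 2) Σg ⟩
    2 * n ∸ 2 + 2                          ≡⟨ m∸n+n≡m (≤-trans 2≤n (m≤m+n n (n + 0))) ⟩
    n + (n + 0)                            ≡⟨ cong (n +_) (+-identityʳ n) ⟩
    n + n                                  ≡⟨ cong₂ _+_ length-allFin length-allFin ⟨
    length (allFin n) + length (allFin n)  ∎
    where open ≡-Reasoning

edgeDisjoint : ∀ {n} {d f : Fin n → ℕ} (P : CaterpillarPair (allFin n) d f) →
               EdgeDisjoint (CaterpillarGraph.graph (cat₁ P)) (CaterpillarGraph.graph (cat₂ P))
edgeDisjoint P i j (e₁ , e₂) = disjoint P i j (∈-allFin i) (∈-allFin j) e₁ e₂

mainTheorem1 : (n : ℕ) → 2 ≤ n → (d f : Fin n → ℕ) →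
    IsTreeSeq n d → IsTreeSeq n f → (∀ i → 3 ≤ d i + f i) →
    Σ (Graph n) λ T₁ → Σ (Graph n) λ T₂ →
    IsCaterpillar T₁ × IsCaterpillar T₂ × Realizes T₁ d × Realizes T₂ f ×
    EdgeDisjoint T₁ T₂
mainTheorem1 n 2≤n d f D F d+f≥3 =
  graph (cat₁ P) , graph (cat₂ P) , isCaterpillar (cat₁ P) , isCaterpillar (cat₂ P) ,
  realizes (cat₁ P) , realizes (cat₂ P) , edgeDisjoint P
  where
  open CaterpillarGraph using (graph; isCaterpillar; realizes)
  P : CaterpillarPair (allFin n) d f
  P = caterpillarPair (TreeSeqPair-allFin 2≤n D F d+f≥3)
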